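{- For every $n\ge0$, the map $F_B$ is a bijection from $\mathrm{PW}_n$ onto the set of blue-packed forests of size $n$, and $T_B$ is a bijection from the set of irreducible packed words of length $n$ onto the set of blue-packed trees of size $n$. Their inverses are the maps $F_B^*$, $T_B^*$ defined recursively by $F_B^*([])=\varepsilon$, $F_B^*([t_1,\dots,t_k])=T_B^*(t_k)\odot T_B^*(t_{k-1})\odot\cdots\odot T_B^*(t_1)$, and $T_B^*(\mathrm{Node}(i^\alpha,f_\ell,f_r))=F_B^*(f_\ell)\triangleleft_B\psi_{i^\alpha}(F_B^*(f_r))$.
   Context: Words over positive integers; $|w|$ length, $\max(w)$ largest letter ($\max(\varepsilon)=0$), $w^{[k]}$ adds $k$ to all letters. Packed: every integer $1..\max(w)$ occurs; $\mathrm{PW}_n$ packed words of length $n$; $\mathrm{pack}(w)$ replaces the $j$-th smallest distinct letter by $j$. $u\odot v=u^{[\max(v)]}\cdot v$ (associative). A global descent of $w\in\mathrm{PW}_n$ is $c$, $1\le c\le n-1$, with every letter among $w_1..w_c$ strictly greater than every letter among $w_{c+1}..w_n$; $w$ is irreducible if nonempty without global descent. Every packed $w$ decomposes uniquely as $w=w_1\odot\cdots\odot w_k$ with irreducible $w_j$. For packed $w$: $\psi_{i^\circ}(w)$ ($1\le i\le\max(w)+1$) adds $1$ to every letter $\ge i$ and appends $i$; $\psi_{i^\bullet}(w)=w\cdot i$ ($1\le i\le\max(w)$). Each nonempty packed $v$ is uniquely $\psi_{i^\alpha}(v')$ ($v'$ packed, $\alpha\in\{\circ,\bullet\}$). For packed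 $u$ and nonempty packed $v=\psi_{i^\alpha}(v')$, $u\triangleleft_B v=\psi_{(i+\max(u))^\alpha}(v'\odot u)$. The blue-factorization of irreducible $w$ is the (unique) pair $(u,v)$, $v\ne\varepsilon$, with $w=u\triangleleft_B v$ and $|u|$ maximal. Biplane trees: $\mathrm{Node}(x,f_\ell,f_r)$ with root label $x$ and ordered possibly empty lists $f_\ell,f_r$ of trees; forests are ordered lists. Blue-packed trees are labeled $i^\alpha$ ($i\ge1$, $\alpha\in\{\circ,\bullet\}$); $\omega$ = number of nodes with $\alpha=\circ$; size = number of nodes. $\mathrm{Node}(i^\alpha,[\ell_1..\ell_g],[r_1..r_d])$ is blue-packed if all children are blue-packed and either ($d=0$, $i^\alpha=1^\circ$) or ($d=1$, $i^\alpha\ne1^\circ$, $1\le i\le\omega(r_1)$); blue-packed forest = list of blue-packed trees. $F_B,T_B$ by mutual recursion: $F_B(\varepsilon)=[]$; for $w=w_1\odot\cdots\odot w_k$ (irreducible decomposition), $F_B(w)=[T_B(w_k),T_B(w_{k-1}),\dots,T_B(w_1)]$; for irreducible $w$ with blue-factorization $(u,\psi_{i^\alpha}(v'))$, $T_B(w)=\mathrm{Node}(i^\alpha,F_B(u),F_B(v'))$. -}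

module Defs where

open import Data.Nat using (ℕ; zero; suc; _+_; _*_; _∸_; _≤_; _<_; _⊔_; _≤ᵇ_; _<ᵇ_; _≡ᵇ_)
import Data.Nat as ℕ
open import Data.Bool using (Bool; true; false; if_then_else_; _∧_; not)
open import Data.List using (List; []; _∷_; _++_; [_]; map; foldr; length; take; drop; upTo; reverse; unsnoc; null)
import Data.List.Properties as LP
open import Data.List.Membership.Propositional using (_∈_)
open import Data.Bool.ListAction using (all; any)
open import Data.Maybe using (Maybe; just; nothing)
open import Data.Product using (_×_; _,_)
open import Relation.Binary.PropositionalEquality using (_≡_; _≢_)
open import Relation.Nullary using (¬_; does)

-- Words (over positive integers; positivity is part of `Packed`)

Word : Set
Word = List ℕ

maxW : Word → ℕ
maxW = foldr _⊔_ 0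

shift : ℕ → Word → Word
shift k = map (k +_)

Packed : Word → Set
Packed w = (∀ x → x ∈ w → 1 ≤ x) × (∀ k → 1 ≤ k → k ≤ maxW w → k ∈ w)

_⊙_ : Word → Word → Word
u ⊙ v = shift (maxW v) u ++ v

GlobalDescent : Word → ℕ → Set
GlobalDescent w c = 1 ≤ c × c ≤ length w ∸ 1
                  × (∀ x y → x ∈ take c w → y ∈ drop c w → y < x)

Irreducible : Word → Set
Irreducible w = w ≢ [] × (∀ c → ¬ GlobalDescent w c)

data Color : Set where
  circ bullet : Color

psi : ℕ → Color → Word → Word
psi i circ   w = map (λ y → if i ≤ᵇ y then suc y else y) w ++ [ i ]
psi i bullet w = w ++ [ i ]

ValidPsi : ℕ → Color → Word → Set
ValidPsi i circ   w = 1 ≤ i × i ≤ suc (maxW w)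
ValidPsi i bullet w = 1 ≤ i × i ≤ maxW w

validPsiᵇ : ℕ → Color → Word → Bool
validPsiᵇ i circ   w = (1 ≤ᵇ i) ∧ (i ≤ᵇ suc (maxW w))
validPsiᵇ i bullet w = (1 ≤ᵇ i) ∧ (i ≤ᵇ maxW w)

-- the unique decomposition v = ψ_{i^α}(v') of a nonempty packed v
-- (default value on ε, never used there)
unpsi : Word → ℕ × Color × Word
unpsi v with unsnoc v
... | nothing = (1 , circ , [])
... | just (p , i) =
  if any (_≡ᵇ i) p then (i , bullet , p)
  else (i , circ , map (λ y → if i <ᵇ y then y ∸ 1 else y) p)

_◁B_ : Word → Word → Word
u ◁B v with unpsi v
... | (i , α , v') = psi (i + maxW u) α (v' ⊙ u)

_==w_ : Word → Word → Bool
u ==w v = does (LP.≡-dec ℕ._≟_ u v)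

isPackedᵇ : Word → Bool
isPackedᵇ w = all (1 ≤ᵇ_) w ∧ all (λ k → any (_≡ᵇ k) w) (map suc (upTo (maxW w)))

descentAtᵇ : Word → ℕ → Bool
descentAtᵇ w c = all (λ x → maxW (drop c w) <ᵇ x) (take c w)

isIrredᵇ : Word → Bool
isIrredᵇ w = not (null w) ∧ not (any (descentAtᵇ w) (map suc (upTo (length w ∸ 1))))

findSplit : Word → List ℕ → Maybe (Word × Word)
findSplit w [] = nothing
findSplit w (c ∷ cs) =
  let r = drop c w
      u = map (λ x → x ∸ maxW r) (take c w)
  in if isPackedᵇ u ∧ isIrredᵇ u ∧ isPackedᵇ r ∧ (w ==w (u ⊙ r))
     then just (u , r) else findSplit w cs

-- irreducible decomposition [w₁, …, w_k] with w = w₁ ⊙ ⋯ ⊙ w_k (fuel-driven)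
decompF : ℕ → Word → List Word
decompF zero    w = []
decompF (suc k) [] = []
decompF (suc k) (x ∷ w) with findSplit (x ∷ w) (map suc (upTo (length (x ∷ w))))
... | nothing      = [ x ∷ w ]
... | just (u , r) = u ∷ decompF k r

decomp : Word → List Word
decomp w = decompF (length w) w

-- blue factorization (u, ψ_{i^α}(v')) of w with |u| maximal, returned as (u, i, α, v').
-- Since |w| = |u| + |v'| + 1, candidates are tried for |u| = |w|-1, |w|-2, …, 0,
-- and each candidate is verified by checking w = u ◁_B ψ_{i^α}(v').
blueCand : Word → List ℕ → Maybe (Word × ℕ × Color × Word)
blueCand w [] = nothing
blueCand w (a ∷ as) with unpsi w
... | (j , α , x) =
  let m  = length x ∸ a
      u  = drop m x
      i  = j ∸ maxW u
      v' = map (λ y → y ∸ maxW u) (take m x)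
  in if isPackedᵇ u ∧ isPackedᵇ v' ∧ validPsiᵇ i α v' ∧ (w ==w (u ◁B psi i α v'))
     then just (u , i , α , v') else blueCand w as

blueFact : Word → Maybe (Word × ℕ × Color × Word)
blueFact w = blueCand w (reverse (upTo (length w)))

data Tree : Set where
  node : ℕ → Color → List Tree → List Tree → Tree

mutual
  sizeT : Tree → ℕ
  sizeT (node _ _ l r) = suc (sizeF l + sizeF r)

  sizeF : List Tree → ℕ
  sizeF []       = 0
  sizeF (t ∷ ts) = sizeT t + sizeF ts

circCount : Color → ℕ
circCount circ   = 1
circCount bullet = 0

mutual
  omegaT : Tree → ℕ
  omegaT (node _ α l r) = circCount α + omegaF l + omegaF r

  omegaF : List Tree → ℕ
  omegaF []       = 0
  omegaF (t ∷ ts) = omegaT t + omegaF ts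

mutual
  data BlueTree : Tree → Set where
    bt0 : ∀ {fl} → BlueForest fl → BlueTree (node 1 circ fl [])
    bt1 : ∀ {fl i α r} → BlueForest fl → BlueTree r →
          ¬ (i ≡ 1 × α ≡ circ) → 1 ≤ i → i ≤ omegaT r →
          BlueTree (node i α fl [ r ])

  data BlueForest : List Tree → Set where
    []  : BlueForest []
    _∷_ : ∀ {t ts} → BlueTree t → BlueForest ts → BlueForest (t ∷ ts)

-- F_B and T_B (mutual recursion, made structural by fuel; any fuel
-- ≥ 2|w|+1 suffices, we use 2|w|+2)

mutual
  FBf : ℕ → Word → List Tree
  FBf zero    w = []
  FBf (suc k) w = reverse (map (TBf k) (decomp w))

  TBf : ℕ → Word → Tree
  TBf zero    w = node 1 circ [] []
  TBf (suc k) w with blueFact w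
  ... | nothing = node 1 circ [] []
  ... | just (u , i , α , v') = node i α (FBf k u) (FBf k v')

F-B : Word → List Tree
F-B w = FBf (2 * length w + 2) w

T-B : Word → Tree
T-B w = TBf (2 * length w + 2) w

-- inverses F_B^*, T_B^*
-- F*([t₁,…,t_k]) = T*(t_k) ⊙ ⋯ ⊙ T*(t₁), computed as F*(t₁ ∷ ts) = F*(ts) ⊙ T*(t₁)
mutual
  F-B* : List Tree → Word
  F-B* []       = []
  F-B* (t ∷ ts) = F-B* ts ⊙ T-B* t

  T-B* : Tree → Word
  T-B* (node i α fl fr) = F-B* fl ◁B psi i α (F-B* fr)

{-# OPTIONS --safe #-}
-- Both maps are computed by search, and the proof identifies what each search finds.
-- The first split found in a ⊙-product of irreducible packed words is its first factor, since an
-- earlier split would be a global descent of that factor; so the irreducible decomposition inverts ⊙.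
-- For packed U, V and x = V ⊙ U, j = i + max U, one has U ◁_B ψ_{i^α}(V) = ψ_{j^α}(x), and the
-- candidates for the blue factorization of this word are the cuts of x after which every letter is
-- below j and below every letter before the cut. Comparing such cuts with global descents,
-- the word is irreducible with blue factorization (U, ψ_{i^α}(V)) exactly when V = ε and i^α = 1°,
-- or V is irreducible, i^α ≠ 1° and i ≤ max V. As max T_B^*(t) = ω(t), this is the blue-packed
-- condition on the right child, and both bijections follow by induction on the size.
module Submission where

open import Defs
open import Data.Nat
open import Data.Nat.Properties
open import Data.Bool using (Bool; true; false; if_then_else_; _∧_)
open import Data.Bool.Properties using (T-≡)
open import Data.Bool.ListAction using (all; any)
open import Data.List
  using ( List; []; _∷_; _++_; [_]; _∷ʳ_; map; foldr; length; take; drop; upTo; downFrom; applyUpTo; reverse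
        ; unsnoc; initLast; _∷ʳ′_)
open import Data.List.Properties
open import Data.List.Membership.Propositional using (_∈_; find; lose)
open import Data.List.Membership.DecPropositional _≟_ using (_∈?_)
open import Data.List.Membership.Propositional.Properties
open import Data.List.Relation.Unary.All as All using (All; []; _∷_)
import Data.List.Relation.Unary.All.Properties as AllP
import Data.List.Relation.Unary.Any.Properties as AnyP
open import Data.List.Relation.Unary.Any using (here; there)
open import Data.Maybe using (just; nothing)
open import Data.Maybe.Properties using (just-injective)
open import Data.Product using (_×_; _,_; proj₁; proj₂; ∃-syntax)
open import Data.Sum using (_⊎_; inj₁; inj₂)
open import Data.Empty using (⊥; ⊥-elim)
open import Function using (_∘_; Equivalence)
open import Relation.Binary.Definitions using (tri<; tri≈; tri>)
open import Relation.Binary.PropositionalEquality hiding ([_])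
open import Relation.Nullary using (¬_; Dec; yes; no; does)
open import Relation.Nullary.Decidable using (dec-true; dec-false)

private
  variable
    A : Set

dec-true⁻ : ∀ {P : Set} (P? : Dec P) → does P? ≡ true → P
dec-true⁻ (yes p) _ = p

∧-true : ∀ {a b} → a ∧ b ≡ true → a ≡ true × b ≡ true
∧-true {true} {true} _ = refl , refl

true-∧ : ∀ {a b} → a ≡ true → b ≡ true → a ∧ b ≡ true
true-∧ refl refl = refl

true≢false : true ≢ false
true≢false ()

≤ᵇ-true : ∀ {m n} → m ≤ n → (m ≤ᵇ n) ≡ true
≤ᵇ-true = dec-true (_ ≤? _)

≤ᵇ-false : ∀ {m n} → n < m → (m ≤ᵇ n) ≡ false
≤ᵇ-false n<m = dec-false (_ ≤? _) (<⇒≱ n<m)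

≤ᵇ-true⁻ : ∀ {m n} → (m ≤ᵇ n) ≡ true → m ≤ n
≤ᵇ-true⁻ = dec-true⁻ (_ ≤? _)

<ᵇ-true : ∀ {m n} → m < n → (m <ᵇ n) ≡ true
<ᵇ-true = dec-true (_ <? _)

<ᵇ-false : ∀ {m n} → n ≤ m → (m <ᵇ n) ≡ false
<ᵇ-false n≤m = dec-false (_ <? _) (≤⇒≯ n≤m)

<ᵇ-true⁻ : ∀ {m n} → (m <ᵇ n) ≡ true → m < n
<ᵇ-true⁻ = dec-true⁻ (_ <? _)

≡ᵇ-true : ∀ {m n} → m ≡ n → (m ≡ᵇ n) ≡ true
≡ᵇ-true = dec-true (_ ≟ _)

≡ᵇ-true⁻ : ∀ {m n} → (m ≡ᵇ n) ≡ true → m ≡ n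
≡ᵇ-true⁻ = dec-true⁻ (_ ≟ _)

==w-true : ∀ {u v} → u ≡ v → (u ==w v) ≡ true
==w-true = dec-true (≡-dec _≟_ _ _)

==w-true⁻ : ∀ {u v} → (u ==w v) ≡ true → u ≡ v
==w-true⁻ = dec-true⁻ (≡-dec _≟_ _ _)

all-true : ∀ (p : A → Bool) xs → (∀ x → x ∈ xs → p x ≡ true) → all p xs ≡ true
all-true p xs h = Equivalence.to T-≡ (AllP.all⁻ p (All.tabulate (λ {x} x∈ → Equivalence.from T-≡ (h x x∈))))

all-true⁻ : ∀ (p : A → Bool) xs → all p xs ≡ true → ∀ x → x ∈ xs → p x ≡ true
all-true⁻ p xs e x x∈ = Equivalence.to T-≡ (All.lookup (AllP.all⁺ p xs (Equivalence.from T-≡ e)) x∈)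

any-true : ∀ (p : A → Bool) {xs} x → x ∈ xs → p x ≡ true → any p xs ≡ true
any-true p x x∈ px = Equivalence.to T-≡ (AnyP.any⁺ p (lose x∈ (Equivalence.from T-≡ px)))

any-true⁻ : ∀ (p : A → Bool) xs → any p xs ≡ true → ∃[ x ] x ∈ xs × p x ≡ true
any-true⁻ p xs e with x , x∈ , px ← find (AnyP.any⁻ p xs (Equivalence.from T-≡ e)) =
  x , x∈ , Equivalence.to T-≡ px

∈-range : ∀ {n k} → 1 ≤ k → k ≤ n → k ∈ map suc (upTo n)
∈-range {n} {suc k} _ k<n = ∈-map⁺ suc (∈-upTo⁺ k<n)

∈-range⁻ : ∀ {n k} → k ∈ map suc (upTo n) → 1 ≤ k × k ≤ n
∈-range⁻ k∈ with _ , i∈ , refl ← ∈-map⁻ suc k∈ = s≤s z≤n , ∈-upTo⁻ i∈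

-- Words and the product ⊙

≡[]⊎≢[] : ∀ (l : List A) → l ≡ [] ⊎ l ≢ []
≡[]⊎≢[] [] = inj₁ refl
≡[]⊎≢[] (_ ∷ _) = inj₂ (λ ())

≢[]⇒0<length : ∀ (l : List A) → l ≢ [] → 0 < length l
≢[]⇒0<length [] l≢[] = ⊥-elim (l≢[] refl)
≢[]⇒0<length (_ ∷ _) _ = s≤s z≤n

∈⇒≤maxW : ∀ {x} l → x ∈ l → x ≤ maxW l
∈⇒≤maxW (y ∷ l) (here refl) = m≤m⊔n y (maxW l)
∈⇒≤maxW (y ∷ l) (there x∈) = ≤-trans (∈⇒≤maxW l x∈) (m≤n⊔m y (maxW l))

maxW≤ : ∀ l {n} → (∀ x → x ∈ l → x ≤ n) → maxW l ≤ n
maxW≤ [] h = z≤n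
maxW≤ (y ∷ l) h = ⊔-lub (h y (here refl)) (maxW≤ l (λ x x∈ → h x (there x∈)))

maxW-∈ : ∀ y l → maxW (y ∷ l) ∈ y ∷ l
maxW-∈ y [] rewrite ⊔-identityʳ y = here refl
maxW-∈ y (z ∷ l) with ≤-total y (maxW (z ∷ l))
... | inj₁ p rewrite m≤n⇒m⊔n≡n p = there (maxW-∈ z l)
... | inj₂ p rewrite m≥n⇒m⊔n≡m p = here refl

maxW< : ∀ l {n} → 0 < n → (∀ x → x ∈ l → x < n) → maxW l < n
maxW< [] 0<n _ = 0<n
maxW< (y ∷ l) _ h = h (maxW (y ∷ l)) (maxW-∈ y l)

maxW∈ : ∀ l → l ≢ [] → maxW l ∈ l
maxW∈ [] l≢[] = ⊥-elim (l≢[] refl)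
maxW∈ (y ∷ l) _ = maxW-∈ y l

≤maxW⇒≢[] : ∀ {k} l → 1 ≤ k → k ≤ maxW l → l ≢ []
≤maxW⇒≢[] l 1≤k k≤ refl = <⇒≱ 1≤k k≤

maxW-++ : ∀ a b → maxW (a ++ b) ≡ maxW a ⊔ maxW b
maxW-++ [] b = refl
maxW-++ (y ∷ a) b rewrite maxW-++ a b = sym (⊔-assoc y (maxW a) (maxW b))

maxW-∷ʳ : ∀ a i → maxW (a ∷ʳ i) ≡ maxW a ⊔ i
maxW-∷ʳ a i = trans (maxW-++ a [ i ]) (cong (maxW a ⊔_) (⊔-identityʳ i))

maxW-shift : ∀ k l → l ≢ [] → maxW (shift k l) ≡ k + maxW l
maxW-shift k [] l≢[] = ⊥-elim (l≢[] refl)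
maxW-shift k (y ∷ []) _ = trans (⊔-identityʳ (k + y)) (cong (k +_) (sym (⊔-identityʳ y)))
maxW-shift k (y ∷ z ∷ l) _ rewrite maxW-shift k (z ∷ l) (λ ()) = sym (+-distribˡ-⊔ k y (maxW (z ∷ l)))

maxW-⊙ : ∀ a b → maxW (a ⊙ b) ≡ maxW a + maxW b
maxW-⊙ [] b = refl
maxW-⊙ a@(_ ∷ _) b = begin
  maxW (shift (maxW b) a ++ b)       ≡⟨ maxW-++ (shift (maxW b) a) b ⟩
  maxW (shift (maxW b) a) ⊔ maxW b   ≡⟨ cong (_⊔ maxW b) (maxW-shift (maxW b) a (λ ())) ⟩
  (maxW b + maxW a) ⊔ maxW b         ≡⟨ m≥n⇒m⊔n≡m (m≤m+n (maxW b) _) ⟩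
  maxW b + maxW a                    ≡⟨ +-comm (maxW b) _ ⟩
  maxW a + maxW b                    ∎
  where open ≡-Reasoning

∈-take⁻ : ∀ {x} n (l : Word) → x ∈ take n l → x ∈ l
∈-take⁻ n l x∈ = subst (_ ∈_) (take++drop≡id n l) (∈-++⁺ˡ x∈)

∈-drop⁻ : ∀ {x} n (l : Word) → x ∈ drop n l → x ∈ l
∈-drop⁻ n l x∈ = subst (_ ∈_) (take++drop≡id n l) (∈-++⁺ʳ (take n l) x∈)

∈-take-head : ∀ {x} {xs : Word} n → 1 ≤ n → x ∈ take n (x ∷ xs)
∈-take-head (suc n) _ = here refl

∈-take⊎drop : ∀ {x} n (l : Word) → x ∈ l → x ∈ take n l ⊎ x ∈ drop n l
∈-take⊎drop n l x∈ = ∈-++⁻ (take n l) (subst (_ ∈_) (sym (take++drop≡id n l)) x∈)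

take-++ˡ : ∀ n (xs ys : Word) → n ≤ length xs → take n (xs ++ ys) ≡ take n xs
take-++ˡ zero xs ys p = refl
take-++ˡ (suc n) (x ∷ xs) ys (s≤s p) = cong (x ∷_) (take-++ˡ n xs ys p)

drop-++ˡ : ∀ n (xs ys : Word) → n ≤ length xs → drop n (xs ++ ys) ≡ drop n xs ++ ys
drop-++ˡ zero xs ys p = refl
drop-++ˡ (suc n) (x ∷ xs) ys (s≤s p) = drop-++ˡ n xs ys p

take-++ʳ : ∀ n (xs ys : Word) → take (length xs + n) (xs ++ ys) ≡ xs ++ take n ys
take-++ʳ n [] ys = refl
take-++ʳ n (x ∷ xs) ys = cong (x ∷_) (take-++ʳ n xs ys)

take-length-++ : ∀ (xs ys : Word) → take (length xs) (xs ++ ys) ≡ xs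
take-length-++ [] ys = refl
take-length-++ (x ∷ xs) ys = cong (x ∷_) (take-length-++ xs ys)

drop-length-++ : ∀ (xs ys : Word) → drop (length xs) (xs ++ ys) ≡ ys
drop-length-++ [] ys = refl
drop-length-++ (x ∷ xs) ys = drop-length-++ xs ys

length-take≤ : ∀ c (w : Word) → c ≤ length w → length (take c w) ≡ c
length-take≤ c w p = trans (length-take c w) (m≤n⇒m⊓n≡m p)

drop≢[] : ∀ c (w : Word) → c < length w → drop c w ≢ []
drop≢[] zero (x ∷ w) p ()
drop≢[] (suc c) (x ∷ w) (s≤s p) = drop≢[] c w p

length-shift : ∀ k u → length (shift k u) ≡ length u
length-shift k = length-map (k +_)

length-⊙ : ∀ u v → length (u ⊙ v) ≡ length u + length v
length-⊙ u v = trans (length-++ (shift (maxW v) u)) (cong (_+ length v) (length-shift (maxW v) u))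

⊙-identityʳ : ∀ u → u ⊙ [] ≡ u
⊙-identityʳ u = trans (++-identityʳ _) (map-id u)

take-⊙ : ∀ u r → take (length u) (u ⊙ r) ≡ shift (maxW r) u
take-⊙ u r = subst (λ n → take n (u ⊙ r) ≡ shift (maxW r) u) (length-shift (maxW r) u) (take-length-++ (shift (maxW r) u) r)

drop-⊙ : ∀ u r → drop (length u) (u ⊙ r) ≡ r
drop-⊙ u r = subst (λ n → drop n (u ⊙ r) ≡ r) (length-shift (maxW r) u) (drop-length-++ (shift (maxW r) u) r)

shift-shift : ∀ a b l → shift a (shift b l) ≡ shift (a + b) l
shift-shift a b [] = refl
shift-shift a b (x ∷ l) = cong₂ _∷_ (sym (+-assoc a b x)) (shift-shift a b l)

⊙-assoc : ∀ a b c → (a ⊙ b) ⊙ c ≡ a ⊙ (b ⊙ c)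
⊙-assoc a b c = begin
  shift (maxW c) (shift (maxW b) a ++ b) ++ c
    ≡⟨ cong (_++ c) (map-++ (maxW c +_) (shift (maxW b) a) b) ⟩
  (shift (maxW c) (shift (maxW b) a) ++ shift (maxW c) b) ++ c
    ≡⟨ ++-assoc (shift (maxW c) (shift (maxW b) a)) _ c ⟩
  shift (maxW c) (shift (maxW b) a) ++ (shift (maxW c) b ++ c)
    ≡⟨ cong (_++ (shift (maxW c) b ++ c)) (shift-shift (maxW c) (maxW b) a) ⟩
  shift (maxW c + maxW b) a ++ (shift (maxW c) b ++ c)
    ≡⟨ cong (λ k → shift k a ++ (shift (maxW c) b ++ c)) (trans (+-comm (maxW c) (maxW b)) (sym (maxW-⊙ b c))) ⟩
  shift (maxW (b ⊙ c)) a ++ (shift (maxW c) b ++ c)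
    ∎
  where open ≡-Reasoning

unshift : ℕ → Word → Word
unshift k = map (_∸ k)

shift-unshift : ∀ k l → (∀ a → a ∈ l → k ≤ a) → shift k (unshift k l) ≡ l
shift-unshift k [] h = refl
shift-unshift k (x ∷ l) h = cong₂ _∷_ (m+[n∸m]≡n (h x (here refl))) (shift-unshift k l (λ a a∈ → h a (there a∈)))

unshift-shift : ∀ k l → unshift k (shift k l) ≡ l
unshift-shift k [] = refl
unshift-shift k (x ∷ l) = cong₂ _∷_ (m+n∸m≡n k x) (unshift-shift k l)

Packed-[] : Packed []
Packed-[] = (λ x ()) , (λ k 1≤k k≤0 → ⊥-elim (<⇒≱ 1≤k k≤0))

Packed-⊙ : ∀ u v → Packed u → Packed v → Packed (u ⊙ v)
Packed-⊙ u v (u>0 , u-onto) (v>0 , v-onto) = positive , onto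
  where
  positive : ∀ x → x ∈ u ⊙ v → 1 ≤ x
  positive x x∈ with ∈-++⁻ (shift (maxW v) u) x∈
  ... | inj₂ x∈v = v>0 x x∈v
  ... | inj₁ x∈su with y , y∈u , refl ← ∈-map⁻ (maxW v +_) x∈su = ≤-trans (u>0 y y∈u) (m≤n+m y (maxW v))
  onto : ∀ k → 1 ≤ k → k ≤ maxW (u ⊙ v) → k ∈ u ⊙ v
  onto k 1≤k k≤max with k ≤? maxW v
  ... | yes k≤mv = ∈-++⁺ʳ (shift (maxW v) u) (v-onto k 1≤k k≤mv)
  ... | no k≰mv = subst (_∈ u ⊙ v) (m+[n∸m]≡n (<⇒≤ mv<k))
                    (∈-++⁺ˡ (∈-map⁺ (maxW v +_) (u-onto (k ∸ maxW v) (m<n⇒0<n∸m mv<k) k-mv≤mu)))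
    where
    mv<k : maxW v < k
    mv<k = ≰⇒> k≰mv
    k-mv≤mu : k ∸ maxW v ≤ maxW u
    k-mv≤mu = ≤-trans (∸-monoˡ-≤ (maxW v) (subst (k ≤_) (maxW-⊙ u v) k≤max))
                      (≤-reflexive (m+n∸n≡m (maxW u) (maxW v)))

Separated : ℕ → Word → Set
Separated c x = ∀ a b → a ∈ take c x → b ∈ drop c x → b < a

Separated-⊙ : ∀ u r → Packed u → Separated (length u) (u ⊙ r)
Separated-⊙ u r (u>0 , _) a b a∈ b∈ rewrite take-⊙ u r | drop-⊙ u r
  with z , z∈u , refl ← ∈-map⁻ (maxW r +_) a∈ =
  ≤-<-trans (∈⇒≤maxW r b∈) (subst (_≤ maxW r + z) (+-comm (maxW r) 1) (+-monoʳ-≤ (maxW r) (u>0 z z∈u)))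

separated-maxW : ∀ c x → (∀ y → y ∈ x → 1 ≤ y) → Separated c x → ∀ a → a ∈ take c x → maxW (drop c x) < a
separated-maxW c x x>0 sep a a∈ = maxW< (drop c x) (x>0 a (∈-take⁻ c x a∈)) (λ b b∈ → sep a b a∈ b∈)

separated-split : ∀ c x → Packed x → Separated c x →
  Packed (unshift (maxW (drop c x)) (take c x)) × Packed (drop c x)
    × x ≡ unshift (maxW (drop c x)) (take c x) ⊙ drop c x
separated-split c x (x>0 , x-onto) sep = (p>0 , p-onto) , (s>0 , s-onto) , x≡
  where
  M = maxW (drop c x)
  pre = take c x
  suf = drop c x
  M<pre : ∀ a → a ∈ pre → M < a
  M<pre = separated-maxW c x x>0 sep
  x≡ : x ≡ unshift M pre ⊙ suf
  x≡ = sym (trans (cong (_++ suf) (shift-unshift M pre (λ a a∈ → <⇒≤ (M<pre a a∈)))) (take++drop≡id c x))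
  s>0 : ∀ y → y ∈ suf → 1 ≤ y
  s>0 y y∈ = x>0 y (∈-drop⁻ c x y∈)
  s-onto : ∀ k → 1 ≤ k → k ≤ M → k ∈ suf
  s-onto k 1≤k k≤M
    with ∈-take⊎drop c x (x-onto k 1≤k (≤-trans k≤M (maxW≤ suf (λ y y∈ → ∈⇒≤maxW x (∈-drop⁻ c x y∈)))))
  ... | inj₂ k∈ = k∈
  ... | inj₁ k∈ = ⊥-elim (<⇒≱ (M<pre k k∈) k≤M)
  p>0 : ∀ y → y ∈ unshift M pre → 1 ≤ y
  p>0 y y∈ with a , a∈ , refl ← ∈-map⁻ (_∸ M) y∈ = m<n⇒0<n∸m (M<pre a a∈)
  p-onto : ∀ k → 1 ≤ k → k ≤ maxW (unshift M pre) → k ∈ unshift M pre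
  p-onto k 1≤k k≤max = subst (_∈ unshift M pre) (m+n∸m≡n M k) (∈-map⁺ (_∸ M) M+k∈pre)
    where
    M+k≤max : M + k ≤ maxW x
    M+k≤max = subst (M + k ≤_) (sym (trans (cong maxW x≡) (maxW-⊙ (unshift M pre) suf)))
                (subst (M + k ≤_) (+-comm M _) (+-monoʳ-≤ M k≤max))
    M+k∈pre : M + k ∈ pre
    M+k∈pre with ∈-take⊎drop c x (x-onto (M + k) (≤-trans 1≤k (m≤n+m k M)) M+k≤max)
    ... | inj₁ k∈ = k∈
    ... | inj₂ k∈ = ⊥-elim (<⇒≱ (m<m+n M 1≤k) (∈⇒≤maxW suf k∈))

-- The operators ψ

raise : ℕ → ℕ → ℕ
raise j y = if j ≤ᵇ y then suc y else y

lower : ℕ → ℕ → ℕ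
lower i y = if i <ᵇ y then y ∸ 1 else y

raise-≥ : ∀ {j y} → j ≤ y → raise j y ≡ suc y
raise-≥ {j} {y} j≤y = cong (λ b → if b then suc y else y) (≤ᵇ-true j≤y)

raise-< : ∀ {j y} → y < j → raise j y ≡ y
raise-< {j} {y} y<j = cong (λ b → if b then suc y else y) (≤ᵇ-false y<j)

lower-> : ∀ {i y} → i < y → lower i y ≡ y ∸ 1
lower-> {i} {y} i<y = cong (λ b → if b then y ∸ 1 else y) (<ᵇ-true i<y)

lower-≤ : ∀ {i y} → y ≤ i → lower i y ≡ y
lower-≤ {i} {y} y≤i = cong (λ b → if b then y ∸ 1 else y) (<ᵇ-false y≤i)

lower-raise : ∀ j y → lower j (raise j y) ≡ y
lower-raise j y with j ≤? y
... | yes j≤y rewrite raise-≥ j≤y | lower-> (s≤s j≤y) = refl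
... | no j≰y rewrite raise-< (≰⇒> j≰y) | lower-≤ (<⇒≤ (≰⇒> j≰y)) = refl

raise-lower : ∀ i y → y ≢ i → raise i (lower i y) ≡ y
raise-lower i y y≢i with <-cmp i y
... | tri< i<y _ _ = begin
  raise i (lower i y)   ≡⟨ cong (raise i) (lower-> i<y) ⟩
  raise i (y ∸ 1)       ≡⟨ raise-≥ (≤-pred (subst (suc i ≤_) (sym y-1+1) i<y)) ⟩
  suc (y ∸ 1)           ≡⟨ y-1+1 ⟩
  y                     ∎
  where
  open ≡-Reasoning
  y-1+1 : suc (y ∸ 1) ≡ y
  y-1+1 = m+[n∸m]≡n (≤-trans (s≤s z≤n) i<y)
... | tri≈ _ i≡y _ = ⊥-elim (y≢i (sym i≡y))
... | tri> _ _ y<i rewrite lower-≤ (<⇒≤ y<i) | raise-< y<i = refl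

raise≢ : ∀ j y → raise j y ≢ j
raise≢ j y with j ≤? y
... | yes j≤y rewrite raise-≥ j≤y = ≢-sym (<⇒≢ (s≤s j≤y))
... | no j≰y rewrite raise-< (≰⇒> j≰y) = <⇒≢ (≰⇒> j≰y)

≤-raise : ∀ j y → y ≤ raise j y
≤-raise j y with j ≤? y
... | yes j≤y rewrite raise-≥ j≤y = n≤1+n y
... | no j≰y rewrite raise-< (≰⇒> j≰y) = ≤-refl

raise-mono-≤ : ∀ j {a b} → a ≤ b → raise j a ≤ raise j b
raise-mono-≤ j {a} {b} a≤b with j ≤? a | j ≤? b
... | yes j≤a | yes j≤b rewrite raise-≥ j≤a | raise-≥ j≤b = s≤s a≤b
... | yes j≤a | no j≰b = ⊥-elim (j≰b (≤-trans j≤a a≤b))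
... | no j≰a | yes j≤b rewrite raise-< (≰⇒> j≰a) | raise-≥ j≤b = m≤n⇒m≤1+n a≤b
... | no j≰a | no j≰b rewrite raise-< (≰⇒> j≰a) | raise-< (≰⇒> j≰b) = a≤b

raise-mono-< : ∀ j {a b} → a < b → raise j a < raise j b
raise-mono-< j {a} {b} a<b with j ≤? a | j ≤? b
... | yes j≤a | yes j≤b rewrite raise-≥ j≤a | raise-≥ j≤b = s≤s a<b
... | yes j≤a | no j≰b = ⊥-elim (j≰b (≤-trans j≤a (<⇒≤ a<b)))
... | no j≰a | yes j≤b rewrite raise-< (≰⇒> j≰a) | raise-≥ j≤b = m≤n⇒m≤1+n a<b
... | no j≰a | no j≰b rewrite raise-< (≰⇒> j≰a) | raise-< (≰⇒> j≰b) = a<b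

psiLetter : ℕ → Color → ℕ → ℕ
psiLetter j circ = raise j
psiLetter j bullet y = y

psiLetter-mono-≤ : ∀ j α {a b} → a ≤ b → psiLetter j α a ≤ psiLetter j α b
psiLetter-mono-≤ j circ = raise-mono-≤ j
psiLetter-mono-≤ j bullet a≤b = a≤b

psiLetter-mono-< : ∀ j α {a b} → a < b → psiLetter j α a < psiLetter j α b
psiLetter-mono-< j circ = raise-mono-< j
psiLetter-mono-< j bullet a<b = a<b

psiLetter-cancel-< : ∀ j α {a b} → psiLetter j α a < psiLetter j α b → a < b
psiLetter-cancel-< j α {a} {b} fa<fb with a <? b
... | yes a<b = a<b
... | no a≮b = ⊥-elim (<⇒≱ fa<fb (psiLetter-mono-≤ j α (≮⇒≥ a≮b)))

psiLetter-< : ∀ j α {y} → y < j → psiLetter j α y ≡ y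
psiLetter-< j circ = raise-<
psiLetter-< j bullet _ = refl

≤-psiLetter : ∀ j α y → y ≤ psiLetter j α y
≤-psiLetter j circ = ≤-raise j
≤-psiLetter j bullet y = ≤-refl

psi-≡ : ∀ j α x → psi j α x ≡ map (psiLetter j α) x ∷ʳ j
psi-≡ j circ x = refl
psi-≡ j bullet x = cong (_∷ʳ j) (sym (map-id x))

length-psi : ∀ j α x → length (psi j α x) ≡ suc (length x)
length-psi j α x rewrite psi-≡ j α x | length-++ (map (psiLetter j α) x) {[ j ]} | length-map (psiLetter j α) x =
  +-comm (length x) 1

psi≢[] : ∀ j α x → psi j α x ≢ []
psi≢[] j α x ψ≡[] with () ← trans (sym (length-psi j α x)) (cong length ψ≡[])

take-psi : ∀ j α x d → d ≤ length x → take d (psi j α x) ≡ map (psiLetter j α) (take d x)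
take-psi j α x d d≤ rewrite psi-≡ j α x =
  trans (take-++ˡ d (map (psiLetter j α) x) [ j ] (subst (d ≤_) (sym (length-map _ x)) d≤)) (take-map d x)

drop-psi : ∀ j α x d → d ≤ length x → drop d (psi j α x) ≡ map (psiLetter j α) (drop d x) ∷ʳ j
drop-psi j α x d d≤ rewrite psi-≡ j α x =
  trans (drop-++ˡ d (map (psiLetter j α) x) [ j ] (subst (d ≤_) (sym (length-map _ x)) d≤)) (cong (_∷ʳ j) (drop-map d x))

ValidPsi⇒1≤ : ∀ j α x → ValidPsi j α x → 1 ≤ j
ValidPsi⇒1≤ j circ x = proj₁
ValidPsi⇒1≤ j bullet x = proj₁

maxW-psi-circ : ∀ j x → ValidPsi j circ x → maxW (psi j circ x) ≡ suc (maxW x)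
maxW-psi-circ j x (1≤j , j≤) = ≤-antisym upper lower-bound
  where
  upper : maxW (psi j circ x) ≤ suc (maxW x)
  upper = maxW≤ (psi j circ x) bound
    where
    bound : ∀ y → y ∈ psi j circ x → y ≤ suc (maxW x)
    bound y y∈ with ∈-++⁻ (map (raise j) x) y∈
    ... | inj₂ (here refl) = j≤
    ... | inj₁ y∈′ with z , z∈ , refl ← ∈-map⁻ (raise j) y∈′ with j ≤? z
    ...   | yes j≤z rewrite raise-≥ j≤z = s≤s (∈⇒≤maxW x z∈)
    ...   | no j≰z rewrite raise-< (≰⇒> j≰z) = m≤n⇒m≤1+n (∈⇒≤maxW x z∈)
  lower-bound : suc (maxW x) ≤ maxW (psi j circ x)
  lower-bound with j ≤? maxW x
  ... | no j≰ = subst (_≤ maxW (psi j circ x)) (≤-antisym j≤ (≰⇒> j≰))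
                  (∈⇒≤maxW (psi j circ x) (∈-++⁺ʳ (map (raise j) x) (here refl)))
  ... | yes j≤max = subst (_≤ maxW (psi j circ x)) (raise-≥ j≤max)
                  (∈⇒≤maxW (psi j circ x) (∈-++⁺ˡ (∈-map⁺ (raise j) (maxW∈ x (≤maxW⇒≢[] x 1≤j j≤max)))))

maxW-psi-bullet : ∀ j x → ValidPsi j bullet x → maxW (psi j bullet x) ≡ maxW x
maxW-psi-bullet j x (_ , j≤) = trans (maxW-∷ʳ x j) (m≥n⇒m⊔n≡m j≤)

Packed-psi : ∀ j α x → Packed x → ValidPsi j α x → Packed (psi j α x)
Packed-psi j bullet x (x>0 , x-onto) valid@(1≤j , _) = positive , onto
  where
  positive : ∀ y → y ∈ psi j bullet x → 1 ≤ y
  positive y y∈ with ∈-++⁻ x y∈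
  ... | inj₁ y∈x = x>0 y y∈x
  ... | inj₂ (here refl) = 1≤j
  onto : ∀ k → 1 ≤ k → k ≤ maxW (psi j bullet x) → k ∈ psi j bullet x
  onto k 1≤k k≤ = ∈-++⁺ˡ (x-onto k 1≤k (subst (k ≤_) (maxW-psi-bullet j x valid) k≤))
Packed-psi j circ x (x>0 , x-onto) valid@(1≤j , j≤) = positive , onto
  where
  positive : ∀ y → y ∈ psi j circ x → 1 ≤ y
  positive y y∈ with ∈-++⁻ (map (raise j) x) y∈
  ... | inj₂ (here refl) = 1≤j
  ... | inj₁ y∈′ with z , z∈ , refl ← ∈-map⁻ (raise j) y∈′ = ≤-trans (x>0 z z∈) (≤-raise j z)
  onto : ∀ k → 1 ≤ k → k ≤ maxW (psi j circ x) → k ∈ psi j circ x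
  onto k 1≤k k≤ with <-cmp k j
  ... | tri≈ _ refl _ = ∈-++⁺ʳ (map (raise j) x) (here refl)
  ... | tri< k<j _ _ = ∈-++⁺ˡ (subst (_∈ map (raise j) x) (raise-< k<j)
                          (∈-map⁺ (raise j) (x-onto k 1≤k (≤-pred (≤-trans k<j j≤)))))
  ... | tri> _ _ j<k = ∈-++⁺ˡ (subst (_∈ map (raise j) x) raise[k-1]≡k
                          (∈-map⁺ (raise j) (x-onto (k ∸ 1) (m<n⇒0<n∸m (≤-<-trans 1≤j j<k)) k-1≤)))
    where
    k-1+1 : suc (k ∸ 1) ≡ k
    k-1+1 = m+[n∸m]≡n (≤-trans 1≤j (<⇒≤ j<k))
    k-1≤ : k ∸ 1 ≤ maxW x
    k-1≤ = ≤-pred (subst (_≤ suc (maxW x)) (sym k-1+1) (subst (k ≤_) (maxW-psi-circ j x valid) k≤))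
    raise[k-1]≡k : raise j (k ∸ 1) ≡ k
    raise[k-1]≡k = trans (raise-≥ (≤-pred (subst (j <_) (sym k-1+1) j<k))) k-1+1

initLast-∷ʳ : ∀ (xs : List A) x → initLast (xs ∷ʳ x) ≡ xs ∷ʳ′ x
initLast-∷ʳ [] x = refl
initLast-∷ʳ (y ∷ xs) x rewrite initLast-∷ʳ xs x = refl

unsnoc-∷ʳ : ∀ (xs : List A) x → unsnoc (xs ∷ʳ x) ≡ just (xs , x)
unsnoc-∷ʳ xs x rewrite initLast-∷ʳ xs x = refl

unpsi-∷ʳ : ∀ p i → unpsi (p ∷ʳ i) ≡
  (if any (_≡ᵇ i) p then (i , bullet , p) else (i , circ , map (lower i) p))
unpsi-∷ʳ p i rewrite unsnoc-∷ʳ p i = refl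

∈⇒any≡ᵇ : ∀ {i p} → i ∈ p → any (_≡ᵇ i) p ≡ true
∈⇒any≡ᵇ {i} i∈ = any-true (_≡ᵇ i) i i∈ (≡ᵇ-true {i} refl)

any≡ᵇ⇒∈ : ∀ {i} p → any (_≡ᵇ i) p ≡ true → i ∈ p
any≡ᵇ⇒∈ {i} p e with y , y∈ , y≡ᵇi ← any-true⁻ (_≡ᵇ i) p e = subst (_∈ p) (≡ᵇ-true⁻ y≡ᵇi) y∈

∉⇒any≡ᵇ : ∀ {i} p → ¬ i ∈ p → any (_≡ᵇ i) p ≡ false
∉⇒any≡ᵇ {i} p i∉ with any (_≡ᵇ i) p in eq
... | false = refl
... | true = ⊥-elim (i∉ (any≡ᵇ⇒∈ p eq))

∉-map-raise : ∀ j x → ¬ j ∈ map (raise j) x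
∉-map-raise j x j∈ with y , _ , j≡ ← ∈-map⁻ (raise j) j∈ = raise≢ j y (sym j≡)

unpsi-psi : ∀ j α x → Packed x → ValidPsi j α x → unpsi (psi j α x) ≡ (j , α , x)
unpsi-psi j circ x _ _ rewrite unpsi-∷ʳ (map (raise j) x) j | ∉⇒any≡ᵇ (map (raise j) x) (∉-map-raise j x) =
  cong (λ z → j , circ , z) (trans (sym (map-∘ x)) (trans (map-cong (lower-raise j) x) (map-id x)))
unpsi-psi j bullet x (_ , x-onto) (1≤j , j≤) rewrite unpsi-∷ʳ x j | ∈⇒any≡ᵇ (x-onto j 1≤j j≤) = refl

record PsiView (w : Word) : Set where
  field
    letter : ℕ
    color : Color
    rest : Word
    unpsi≡ : unpsi w ≡ (letter , color , rest)
    rest-packed : Packed rest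
    valid : ValidPsi letter color rest
    psi≡ : psi letter color rest ≡ w

module _ (p : Word) (i : ℕ) (pw : Packed (p ∷ʳ i)) where

  private
    w>0 = proj₁ pw
    w-onto = proj₂ pw
    1≤i : 1 ≤ i
    1≤i = w>0 i (∈-++⁺ʳ p (here refl))
    p-onto : ∀ k → 1 ≤ k → k ≤ maxW (p ∷ʳ i) → k ≢ i → k ∈ p
    p-onto k 1≤k k≤ k≢i with ∈-++⁻ p (w-onto k 1≤k k≤)
    ... | inj₁ k∈ = k∈
    ... | inj₂ (here k≡i) = ⊥-elim (k≢i k≡i)
    ∈p⇒≤max : ∀ {y} → y ∈ p → y ≤ maxW (p ∷ʳ i)
    ∈p⇒≤max y∈ = ∈⇒≤maxW (p ∷ʳ i) (∈-++⁺ˡ y∈)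
    i≤max : i ≤ maxW (p ∷ʳ i)
    i≤max = ∈⇒≤maxW (p ∷ʳ i) (∈-++⁺ʳ p (here refl))

  psiView-bullet : i ∈ p → PsiView (p ∷ʳ i)
  psiView-bullet i∈p = record
    { unpsi≡ = trans (unpsi-∷ʳ p i) (cong (if_then (i , bullet , p) else (i , circ , map (lower i) p)) (∈⇒any≡ᵇ i∈p))
    ; rest-packed = (λ y y∈ → w>0 y (∈-++⁺ˡ y∈)) , onto
    ; valid = 1≤i , ∈⇒≤maxW p i∈p
    ; psi≡ = refl
    }
    where
    onto : ∀ k → 1 ≤ k → k ≤ maxW p → k ∈ p
    onto k 1≤k k≤ with k ≟ i
    ... | yes refl = i∈p
    ... | no k≢i = p-onto k 1≤k (≤-trans k≤ (maxW≤ p (λ y → ∈p⇒≤max))) k≢i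

  module _ (i∉p : ¬ i ∈ p) where

    private
      x = map (lower i) p
      ≢i : ∀ {y} → y ∈ p → y ≢ i
      ≢i y∈ refl = i∉p y∈
      lower∈ : ∀ {k} → 1 ≤ k → k ≤ maxW (p ∷ʳ i) → k ≢ i → lower i k ∈ x
      lower∈ 1≤k k≤ k≢i = ∈-map⁺ (lower i) (p-onto _ 1≤k k≤ k≢i)

    lower-positive : ∀ y → y ∈ map (lower i) p → 1 ≤ y
    lower-positive y y∈ with z , z∈ , refl ← ∈-map⁻ (lower i) y∈ with <-cmp i z
    ... | tri< i<z _ _ rewrite lower-> i<z = m<n⇒0<n∸m (≤-<-trans 1≤i i<z)
    ... | tri≈ _ i≡z _ = ⊥-elim (≢i z∈ (sym i≡z))
    ... | tri> _ _ z<i rewrite lower-≤ (<⇒≤ z<i) = w>0 z (∈-++⁺ˡ z∈)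

    lower-onto-below : ∀ {k} z → 1 ≤ k → z ∈ p → k ≤ lower i z → k ∈ map (lower i) p
    lower-onto-below {k} z 1≤k z∈ k≤ with <-cmp i z
    ... | tri≈ _ i≡z _ = ⊥-elim (≢i z∈ (sym i≡z))
    ... | tri> _ _ z<i rewrite lower-≤ (<⇒≤ z<i) =
          subst (_∈ x) (lower-≤ (<⇒≤ k<i)) (lower∈ 1≤k (≤-trans k≤ (∈p⇒≤max z∈)) (<⇒≢ k<i))
      where
      k<i : k < i
      k<i = ≤-<-trans k≤ z<i
    ... | tri< i<z _ _ rewrite lower-> i<z with k <? i
    ...   | yes k<i = subst (_∈ x) (lower-≤ (<⇒≤ k<i)) (lower∈ 1≤k (≤-trans (<⇒≤ k<i) i≤max) (<⇒≢ k<i))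
    ...   | no k≮i = subst (_∈ x) (lower-> {i} {suc k} (s≤s (≮⇒≥ k≮i)))
                       (lower∈ (s≤s z≤n) 1+k≤ (λ 1+k≡i → k≮i (subst (k <_) 1+k≡i ≤-refl)))
      where
      1+k≤ : suc k ≤ maxW (p ∷ʳ i)
      1+k≤ = ≤-trans (subst (suc k ≤_) (m+[n∸m]≡n (≤-<-trans z≤n i<z)) (s≤s k≤)) (∈p⇒≤max z∈)

    lower-onto : ∀ k → 1 ≤ k → k ≤ maxW (map (lower i) p) → k ∈ map (lower i) p
    lower-onto k 1≤k k≤max with z , z∈ , max≡ ← ∈-map⁻ (lower i) (maxW∈ x (≤maxW⇒≢[] x 1≤k k≤max)) =
      lower-onto-below z 1≤k z∈ (subst (k ≤_) max≡ k≤max)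

    ≤1+maxW-lower : i ≤ suc (maxW (map (lower i) p))
    ≤1+maxW-lower with i ≟ 1
    ... | yes refl = s≤s z≤n
    ... | no i≢1 = subst (_≤ suc (maxW x)) i-1+1 (s≤s (subst (_≤ maxW x) (lower-≤ (m∸n≤m i 1)) (∈⇒≤maxW x i-1∈)))
      where
      i-1+1 : suc (i ∸ 1) ≡ i
      i-1+1 = m+[n∸m]≡n 1≤i
      i-1∈ : lower i (i ∸ 1) ∈ x
      i-1∈ = lower∈ (m<n⇒0<n∸m (≤∧≢⇒< 1≤i (≢-sym i≢1))) (≤-trans (m∸n≤m i 1) i≤max)
                    (<⇒≢ (≤-reflexive i-1+1))

    psiView-circ : PsiView (p ∷ʳ i)
    psiView-circ = record
      { unpsi≡ = trans (unpsi-∷ʳ p i) (cong (if_then (i , bullet , p) else (i , circ , x)) (∉⇒any≡ᵇ p i∉p))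
      ; rest-packed = lower-positive , lower-onto
      ; valid = 1≤i , ≤1+maxW-lower
      ; psi≡ = cong (_∷ʳ i) (trans (sym (map-∘ p)) (map-id-local (All.tabulate (λ {y} y∈ → raise-lower i y (≢i y∈)))))
      }

psiView : ∀ w → Packed w → w ≢ [] → PsiView w
psiView w pw w≢[] with initLast w
... | [] = ⊥-elim (w≢[] refl)
... | p ∷ʳ′ i with i ∈? p
...   | yes i∈p = psiView-bullet p i pw i∈p
...   | no i∉p = psiView-circ p i pw i∉p

-- Irreducible decomposition

isPackedᵇ-true : ∀ w → Packed w → isPackedᵇ w ≡ true
isPackedᵇ-true w (w>0 , w-onto) = true-∧
  (all-true (1 ≤ᵇ_) w (λ x x∈ → ≤ᵇ-true (w>0 x x∈)))
  (all-true _ (map suc (upTo (maxW w))) (λ k k∈ → let 1≤k , k≤ = ∈-range⁻ k∈ in ∈⇒any≡ᵇ (w-onto k 1≤k k≤)))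

isPackedᵇ-true⁻ : ∀ w → isPackedᵇ w ≡ true → Packed w
isPackedᵇ-true⁻ w e with e₁ , e₂ ← ∧-true {all (1 ≤ᵇ_) w} e =
  (λ x x∈ → ≤ᵇ-true⁻ (all-true⁻ (1 ≤ᵇ_) w e₁ x x∈)) ,
  (λ k 1≤k k≤ → any≡ᵇ⇒∈ w (all-true⁻ _ (map suc (upTo (maxW w))) e₂ k (∈-range 1≤k k≤)))

validPsiᵇ-true : ∀ i α v → ValidPsi i α v → validPsiᵇ i α v ≡ true
validPsiᵇ-true i circ v (1≤i , i≤) = true-∧ (≤ᵇ-true 1≤i) (≤ᵇ-true i≤)
validPsiᵇ-true i bullet v (1≤i , i≤) = true-∧ (≤ᵇ-true 1≤i) (≤ᵇ-true i≤)

validPsiᵇ-true⁻ : ∀ i α v → validPsiᵇ i α v ≡ true → ValidPsi i α v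
validPsiᵇ-true⁻ i circ v e = let e₁ , e₂ = ∧-true {1 ≤ᵇ i} e in ≤ᵇ-true⁻ e₁ , ≤ᵇ-true⁻ e₂
validPsiᵇ-true⁻ i bullet v e = let e₁ , e₂ = ∧-true {1 ≤ᵇ i} e in ≤ᵇ-true⁻ e₁ , ≤ᵇ-true⁻ e₂

≤length∸1⇒< : ∀ c (w : Word) → 1 ≤ c → c ≤ length w ∸ 1 → c < length w
≤length∸1⇒< c [] 1≤c c≤ = ⊥-elim (<⇒≱ 1≤c c≤)
≤length∸1⇒< c (x ∷ w) _ c≤ = s≤s c≤

GlobalDescent⇒descentAtᵇ : ∀ w c → GlobalDescent w c → descentAtᵇ w c ≡ true
GlobalDescent⇒descentAtᵇ w c (1≤c , c≤ , desc) = all-true _ (take c w)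
  (λ x x∈ → <ᵇ-true (desc x _ x∈ (maxW∈ (drop c w) (drop≢[] c w (≤length∸1⇒< c w 1≤c c≤)))))

descentAtᵇ⇒GlobalDescent : ∀ w c → 1 ≤ c → c ≤ length w ∸ 1 → descentAtᵇ w c ≡ true → GlobalDescent w c
descentAtᵇ⇒GlobalDescent w c 1≤c c≤ e = 1≤c , c≤ ,
  (λ x y x∈ y∈ → ≤-<-trans (∈⇒≤maxW (drop c w) y∈) (<ᵇ-true⁻ (all-true⁻ _ (take c w) e x x∈)))

isIrredᵇ-true : ∀ w → Irreducible w → isIrredᵇ w ≡ true
isIrredᵇ-true [] (w≢[] , _) = ⊥-elim (w≢[] refl)
isIrredᵇ-true w@(_ ∷ _) (_ , no-descent) with any (descentAtᵇ w) (map suc (upTo (length w ∸ 1))) in eq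
... | false = refl
... | true with c , c∈ , desc ← any-true⁻ _ _ eq =
  let 1≤c , c≤ = ∈-range⁻ c∈ in ⊥-elim (no-descent c (descentAtᵇ⇒GlobalDescent w c 1≤c c≤ desc))

isIrredᵇ-true⁻ : ∀ w → isIrredᵇ w ≡ true → Irreducible w
isIrredᵇ-true⁻ w@(_ ∷ _) e = (λ ()) , no-descent
  where
  no-descent : ∀ c → ¬ GlobalDescent w c
  no-descent c gd@(1≤c , c≤ , _) with any (descentAtᵇ w) (map suc (upTo (length w ∸ 1))) in eq
  ... | false = true≢false (trans (sym (any-true _ c (∈-range 1≤c c≤) (GlobalDescent⇒descentAtᵇ w c gd))) eq)

isIrredᵇ-false⁻ : ∀ w → w ≢ [] → isIrredᵇ w ≡ false → ∃[ c ] GlobalDescent w c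
isIrredᵇ-false⁻ [] w≢[] _ = ⊥-elim (w≢[] refl)
isIrredᵇ-false⁻ w@(_ ∷ _) _ e with any (descentAtᵇ w) (map suc (upTo (length w ∸ 1))) in eq
... | true with c , c∈ , desc ← any-true⁻ _ _ eq =
  let 1≤c , c≤ = ∈-range⁻ c∈ in c , descentAtᵇ⇒GlobalDescent w c 1≤c c≤ desc

IrreduciblePacked : Word → Set
IrreduciblePacked u = Packed u × Irreducible u

Irreducible⇒1≤length : ∀ {u} → Irreducible u → 1 ≤ length u
Irreducible⇒1≤length {[]} (u≢[] , _) = ⊥-elim (u≢[] refl)
Irreducible⇒1≤length {_ ∷ _} _ = s≤s z≤n

record Factorisation (w u r : Word) : Set where
  field
    head-packed : Packed u
    head-irreducible : Irreducible u
    tail-packed : Packed r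
    w≡u⊙r : w ≡ u ⊙ r

cutAt : Word → ℕ → Word × Word
cutAt w c = unshift (maxW (drop c w)) (take c w) , drop c w

splitTest : Word → ℕ → Bool
splitTest w c = isPackedᵇ (proj₁ (cutAt w c)) ∧ isIrredᵇ (proj₁ (cutAt w c))
              ∧ isPackedᵇ (drop c w) ∧ (w ==w (proj₁ (cutAt w c) ⊙ drop c w))

splitTest-true⁻ : ∀ w c → splitTest w c ≡ true → Factorisation w (proj₁ (cutAt w c)) (proj₂ (cutAt w c))
splitTest-true⁻ w c e
  with e₁ , e′ ← ∧-true {isPackedᵇ (proj₁ (cutAt w c))} e
  with e₂ , e″ ← ∧-true {isIrredᵇ (proj₁ (cutAt w c))} e′
  with e₃ , e₄ ← ∧-true {isPackedᵇ (drop c w)} e″ = record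
  { head-packed = isPackedᵇ-true⁻ _ e₁
  ; head-irreducible = isIrredᵇ-true⁻ _ e₂
  ; tail-packed = isPackedᵇ-true⁻ _ e₃
  ; w≡u⊙r = ==w-true⁻ e₄
  }

splitTest-true : ∀ w u r → Factorisation w u r → splitTest w (length u) ≡ true × cutAt w (length u) ≡ (u , r)
splitTest-true w u r f rewrite Factorisation.w≡u⊙r f | take-⊙ u r | drop-⊙ u r | unshift-shift (maxW r) u =
  true-∧ (isPackedᵇ-true u (Factorisation.head-packed f))
    (true-∧ (isIrredᵇ-true u (Factorisation.head-irreducible f))
      (true-∧ (isPackedᵇ-true r (Factorisation.tail-packed f)) (==w-true {u ⊙ r} refl))) ,
  refl

findSplit-first : ∀ w (f : ℕ → ℕ) n c₀ → c₀ < n → splitTest w (f c₀) ≡ true →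
  (∀ c → c < c₀ → splitTest w (f c) ≡ false) → findSplit w (applyUpTo f n) ≡ just (cutAt w (f c₀))
findSplit-first w f (suc n) zero _ e _ rewrite e = refl
findSplit-first w f (suc n) (suc c₀) (s≤s c₀<n) e earlier rewrite earlier 0 (s≤s z≤n) =
  findSplit-first w (f ∘ suc) n c₀ c₀<n e (λ c c<c₀ → earlier (suc c) (s≤s c<c₀))

findSplit-just⁻ : ∀ w cs r → findSplit w cs ≡ just r → ∃[ c ] splitTest w c ≡ true × cutAt w c ≡ r
findSplit-just⁻ w (c ∷ cs) r e with splitTest w c in eq
... | true = c , eq , just-injective e
... | false = findSplit-just⁻ w cs r e

findSplit-nothing⁻ : ∀ w (f : ℕ → ℕ) n → findSplit w (applyUpTo f n) ≡ nothing →
  ∀ i → i < n → splitTest w (f i) ≡ false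
findSplit-nothing⁻ w f (suc n) e i i<n with splitTest w (f 0) in eq | i | i<n
... | false | zero | _ = eq
... | false | suc i | s≤s i<n = findSplit-nothing⁻ w (f ∘ suc) n e i i<n

factorisation-exists : ∀ n w → length w ≤ n → Packed w → w ≢ [] → ∃[ u ] ∃[ r ] Factorisation w u r
factorisation-exists n w _ pw w≢[] with isIrredᵇ w in eq
... | true = w , [] , record
  { head-packed = pw ; head-irreducible = isIrredᵇ-true⁻ w eq ; tail-packed = Packed-[] ; w≡u⊙r = sym (⊙-identityʳ w) }
factorisation-exists zero [] _ _ w≢[] | false = ⊥-elim (w≢[] refl)
factorisation-exists (suc n) w |w|≤ pw w≢[] | false
  with c , (1≤c , c≤ , desc) ← isIrredᵇ-false⁻ w w≢[] eq =
  extend (factorisation-exists n p |p|≤n p-packed p≢[])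
  where
  p = proj₁ (cutAt w c)
  split = separated-split c w pw desc
  p-packed = proj₁ split
  extend : ∃[ u ] ∃[ r ] Factorisation p u r → ∃[ u ] ∃[ r ] Factorisation w u r
  extend (u , r , f) = u , r ⊙ drop c w , record
    { head-packed = Factorisation.head-packed f
    ; head-irreducible = Factorisation.head-irreducible f
    ; tail-packed = Packed-⊙ r (drop c w) (Factorisation.tail-packed f) (proj₁ (proj₂ split))
    ; w≡u⊙r = trans (proj₂ (proj₂ split)) (trans (cong (_⊙ drop c w) (Factorisation.w≡u⊙r f)) (⊙-assoc u r (drop c w)))
    }
  c<|w| : c < length w
  c<|w| = ≤length∸1⇒< c w 1≤c c≤
  |p|≡c : length p ≡ c
  |p|≡c = trans (length-map _ (take c w)) (length-take≤ c w (<⇒≤ c<|w|))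
  |p|≤n : length p ≤ n
  |p|≤n = ≤-pred (≤-trans (subst (_< length w) (sym |p|≡c) c<|w|) |w|≤)
  p≢[] : p ≢ []
  p≢[] p≡[] = <⇒≱ 1≤c (subst (_≤ 0) |p|≡c (≤-reflexive (cong length p≡[])))

⊙-concat : List Word → Word
⊙-concat = foldr _⊙_ []

Packed-⊙-concat : ∀ ws → All IrreduciblePacked ws → Packed (⊙-concat ws)
Packed-⊙-concat [] [] = Packed-[]
Packed-⊙-concat (a ∷ ws) ((pa , _) ∷ h) = Packed-⊙ a (⊙-concat ws) pa (Packed-⊙-concat ws h)

⊙-concat-++ : ∀ xs ys → ⊙-concat (xs ++ ys) ≡ ⊙-concat xs ⊙ ⊙-concat ys
⊙-concat-++ [] ys = refl
⊙-concat-++ (a ∷ xs) ys rewrite ⊙-concat-++ xs ys = sym (⊙-assoc a (⊙-concat xs) (⊙-concat ys))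

decompF-just : ∀ k w u r → w ≢ [] → findSplit w (map suc (upTo (length w))) ≡ just (u , r) →
  decompF (suc k) w ≡ u ∷ decompF k r
decompF-just k [] u r w≢[] _ = ⊥-elim (w≢[] refl)
decompF-just k (x ∷ w) u r _ e rewrite e = refl

decompF-sound : ∀ k w → Packed w → length w ≤ k →
  All IrreduciblePacked (decompF k w) × ⊙-concat (decompF k w) ≡ w
decompF-sound zero [] _ _ = [] , refl
decompF-sound (suc k) [] _ _ = [] , refl
decompF-sound (suc k) w@(_ ∷ _) pw |w|≤ with findSplit w (map suc (upTo (length w))) in eq
... | nothing = ⊥-elim (true≢false (trans (sym test) (findSplit-nothing⁻ w suc (length w) eq′ (length u ∸ 1) i<)))
  where
  eq′ : findSplit w (applyUpTo suc (length w)) ≡ nothing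
  eq′ = trans (cong (findSplit w) (sym (map-upTo suc (length w)))) eq
  factorisation = factorisation-exists (length w) w ≤-refl pw (λ ())
  u = proj₁ factorisation
  r = proj₁ (proj₂ factorisation)
  f = proj₂ (proj₂ factorisation)
  |u|-1+1 : suc (length u ∸ 1) ≡ length u
  |u|-1+1 = m+[n∸m]≡n (Irreducible⇒1≤length (Factorisation.head-irreducible f))
  i< : length u ∸ 1 < length w
  i< = subst (_≤ length w) (sym |u|-1+1)
         (subst (length u ≤_) (sym (trans (cong length (Factorisation.w≡u⊙r f)) (length-⊙ u r))) (m≤m+n _ _))
  test : splitTest w (suc (length u ∸ 1)) ≡ true
  test = subst (λ c → splitTest w c ≡ true) (sym |u|-1+1) (proj₁ (splitTest-true w u r f))
... | just (u , r) with c , test , cut≡ ← findSplit-just⁻ w (map suc (upTo (length w))) (u , r) eq =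
  (Factorisation.head-packed f , Factorisation.head-irreducible f) ∷ proj₁ rec ,
  trans (cong (u ⊙_) (proj₂ rec)) (sym (Factorisation.w≡u⊙r f))
  where
  f : Factorisation w u r
  f = subst (λ p → Factorisation w (proj₁ p) (proj₂ p)) cut≡ (splitTest-true⁻ w c test)
  |r|≤k : length r ≤ k
  |r|≤k = ≤-pred (≤-trans (subst (length r <_) (sym (trans (cong length (Factorisation.w≡u⊙r f)) (length-⊙ u r)))
            (+-monoˡ-≤ (length r) (Irreducible⇒1≤length (Factorisation.head-irreducible f)))) |w|≤)
  rec = decompF-sound k r (Factorisation.tail-packed f) |r|≤k

-- A split found before |a| would be a global descent of the irreducible a.
splitTest-before-head : ∀ a rest d → Irreducible a → splitTest (a ⊙ rest) d ≡ true → 1 ≤ d → d < length a → ⊥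
splitTest-before-head a rest d (_ , no-descent) test 1≤d d<|a| = no-descent d (1≤d , d≤ , descent)
  where
  w = a ⊙ rest
  M = maxW rest
  f = splitTest-true⁻ w d test
  d≤|w| : d ≤ length w
  d≤|w| = ≤-trans (<⇒≤ d<|a|) (subst (length a ≤_) (sym (length-⊙ a rest)) (m≤m+n _ _))
  |u|≡d : length (proj₁ (cutAt w d)) ≡ d
  |u|≡d = trans (length-map _ (take d w)) (length-take≤ d w d≤|w|)
  sep : Separated d w
  sep = subst (λ c → Separated c w) |u|≡d
          (subst (Separated (length (proj₁ (cutAt w d)))) (sym (Factorisation.w≡u⊙r f))
            (Separated-⊙ _ (proj₂ (cutAt w d)) (Factorisation.head-packed f)))
  d≤ : d ≤ length a ∸ 1
  d≤ = ≤-pred (subst (suc d ≤_) (sym (m+[n∸m]≡n (≤-trans 1≤d (<⇒≤ d<|a|)))) d<|a|)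
  d≤|sa| : d ≤ length (shift M a)
  d≤|sa| = subst (d ≤_) (sym (length-shift M a)) (<⇒≤ d<|a|)
  descent : ∀ x y → x ∈ take d a → y ∈ drop d a → y < x
  descent x y x∈ y∈ = +-cancelˡ-< M y x (sep (M + x) (M + y)
    (subst (M + x ∈_) (sym (trans (take-++ˡ d (shift M a) rest d≤|sa|) (take-map d a))) (∈-map⁺ (M +_) x∈))
    (subst (M + y ∈_) (sym (trans (drop-++ˡ d (shift M a) rest d≤|sa|) (cong (_++ rest) (drop-map d a))))
      (∈-++⁺ˡ (∈-map⁺ (M +_) y∈))))

findSplit-⊙ : ∀ a rest → IrreduciblePacked a → Packed rest →
  findSplit (a ⊙ rest) (map suc (upTo (length (a ⊙ rest)))) ≡ just (a , rest)
findSplit-⊙ a rest (pa , ia) pr = begin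
  findSplit w (map suc (upTo (length w)))                ≡⟨ cong (findSplit w) (map-upTo suc (length w)) ⟩
  findSplit w (applyUpTo suc (length w))                 ≡⟨ findSplit-first w suc (length w) (length a ∸ 1) i< test earlier ⟩
  just (cutAt w (suc (length a ∸ 1)))                    ≡⟨ cong just cut≡ ⟩
  just (a , rest)                                        ∎
  where
  open ≡-Reasoning
  w = a ⊙ rest
  |a|-1+1 : suc (length a ∸ 1) ≡ length a
  |a|-1+1 = m+[n∸m]≡n (Irreducible⇒1≤length ia)
  i< : length a ∸ 1 < length w
  i< = subst (_≤ length w) (sym |a|-1+1) (subst (length a ≤_) (sym (length-⊙ a rest)) (m≤m+n _ _))
  found = splitTest-true w a rest (record { head-packed = pa ; head-irreducible = ia ; tail-packed = pr ; w≡u⊙r = refl })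
  test : splitTest w (suc (length a ∸ 1)) ≡ true
  test = subst (λ c → splitTest w c ≡ true) (sym |a|-1+1) (proj₁ found)
  cut≡ : cutAt w (suc (length a ∸ 1)) ≡ (a , rest)
  cut≡ = subst (λ c → cutAt w c ≡ (a , rest)) (sym |a|-1+1) (proj₂ found)
  earlier : ∀ c → c < length a ∸ 1 → splitTest w (suc c) ≡ false
  earlier c c< with splitTest w (suc c) in eq
  ... | false = refl
  ... | true = ⊥-elim (splitTest-before-head a rest (suc c) ia eq (s≤s z≤n) (subst (suc (suc c) ≤_) |a|-1+1 (s≤s c<)))

decompF-⊙-concat : ∀ k ws → All IrreduciblePacked ws → length (⊙-concat ws) ≤ k → decompF k (⊙-concat ws) ≡ ws
decompF-⊙-concat zero [] _ _ = refl
decompF-⊙-concat (suc k) [] _ _ = refl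
decompF-⊙-concat zero (a ∷ ws) ((_ , ia) ∷ _) |w|≤0 =
  ⊥-elim (<⇒≱ (≤-trans (Irreducible⇒1≤length ia)
                        (subst (length a ≤_) (sym (length-⊙ a (⊙-concat ws))) (m≤m+n _ _))) |w|≤0)
decompF-⊙-concat (suc k) (a ∷ ws) ((pa , ia) ∷ h) |w|≤ =
  trans (decompF-just k w a rest w≢[] (findSplit-⊙ a rest (pa , ia) (Packed-⊙-concat ws h)))
        (cong (a ∷_) (decompF-⊙-concat k ws h |rest|≤k))
  where
  rest = ⊙-concat ws
  w = a ⊙ rest
  |w|≡ : length w ≡ length a + length rest
  |w|≡ = length-⊙ a rest
  1+|rest|≤|w| : suc (length rest) ≤ length w
  1+|rest|≤|w| = subst (suc (length rest) ≤_) (sym |w|≡) (+-monoˡ-≤ (length rest) (Irreducible⇒1≤length ia))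
  w≢[] : w ≢ []
  w≢[] w≡[] = <⇒≱ (≤-trans (s≤s z≤n) 1+|rest|≤|w|) (≤-reflexive (cong length w≡[]))
  |rest|≤k : length rest ≤ k
  |rest|≤k = ≤-pred (≤-trans 1+|rest|≤|w| |w|≤)

-- Blue factorization

blueSuffix : Word → ℕ → Word
blueSuffix x a = drop (length x ∸ a) x

bluePrefix : Word → ℕ → Word
bluePrefix x a = unshift (maxW (blueSuffix x a)) (take (length x ∸ a) x)

blueTest : Word → ℕ → Color → Word → ℕ → Bool
blueTest w j α x a =
  isPackedᵇ (blueSuffix x a) ∧ isPackedᵇ (bluePrefix x a) ∧ validPsiᵇ (j ∸ maxW (blueSuffix x a)) α (bluePrefix x a)
  ∧ (w ==w (blueSuffix x a ◁B psi (j ∸ maxW (blueSuffix x a)) α (bluePrefix x a)))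

blueResult : ℕ → Color → Word → ℕ → Word × ℕ × Color × Word
blueResult j α x a = blueSuffix x a , j ∸ maxW (blueSuffix x a) , α , bluePrefix x a

blueCand-∷ : ∀ w j α x a as → unpsi w ≡ (j , α , x) →
  blueCand w (a ∷ as) ≡ (if blueTest w j α x a then just (blueResult j α x a) else blueCand w as)
blueCand-∷ w j α x a as e with unpsi w | e
... | _ | refl = refl

blueFact-downFrom : ∀ w → blueFact w ≡ blueCand w (downFrom (length w))
blueFact-downFrom w = cong (blueCand w) (reverse-upTo (length w))

module BlueSearch (w : Word) (j : ℕ) (α : Color) (x : Word) (unpsi≡ : unpsi w ≡ (j , α , x)) where

  private
    step : ∀ n → blueCand w (downFrom (suc n)) ≡
      (if blueTest w j α x n then just (blueResult j α x n) else blueCand w (downFrom n))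
    step n = blueCand-∷ w j α x n (downFrom n) unpsi≡

    step-true : ∀ n → blueTest w j α x n ≡ true → blueCand w (downFrom (suc n)) ≡ just (blueResult j α x n)
    step-true n t = trans (step n) (cong (if_then just (blueResult j α x n) else blueCand w (downFrom n)) t)

    step-false : ∀ n → blueTest w j α x n ≡ false → blueCand w (downFrom (suc n)) ≡ blueCand w (downFrom n)
    step-false n t = trans (step n) (cong (if_then just (blueResult j α x n) else blueCand w (downFrom n)) t)

  blueCand-largest : ∀ n a₀ → a₀ < n → blueTest w j α x a₀ ≡ true →
    (∀ a → a₀ < a → a < n → blueTest w j α x a ≡ false) → blueCand w (downFrom n) ≡ just (blueResult j α x a₀)
  blueCand-largest (suc n) a₀ a₀<1+n test later with a₀ ≟ n
  ... | yes refl = step-true a₀ test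
  ... | no a₀≢n = trans (step-false n (later n a₀<n ≤-refl))
    (blueCand-largest n a₀ a₀<n test (λ a a₀<a a<n → later a a₀<a (m≤n⇒m≤1+n a<n)))
    where
    a₀<n : a₀ < n
    a₀<n = ≤∧≢⇒< (≤-pred a₀<1+n) a₀≢n

  blueCand-just⁻ : ∀ n r → blueCand w (downFrom n) ≡ just r →
    ∃[ a₀ ] a₀ < n × blueTest w j α x a₀ ≡ true × blueResult j α x a₀ ≡ r
      × (∀ a → a₀ < a → a < n → blueTest w j α x a ≡ false)
  blueCand-just⁻ (suc n) r e with blueTest w j α x n in test
  ... | true = n , ≤-refl , test , just-injective (trans (sym (step-true n test)) e) ,
               (λ a n<a a<1+n → ⊥-elim (<⇒≱ n<a (≤-pred a<1+n)))
  ... | false with a₀ , a₀<n , test₀ , res , later ← blueCand-just⁻ n r (trans (sym (step-false n test)) e) =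
    a₀ , m≤n⇒m≤1+n a₀<n , test₀ , res , later′
    where
    later′ : ∀ a → a₀ < a → a < suc n → blueTest w j α x a ≡ false
    later′ a a₀<a a<1+n with a ≟ n
    ... | yes refl = test
    ... | no a≢n = later a a₀<a (≤∧≢⇒< (≤-pred a<1+n) a≢n)

  blueCand-≢nothing : ∀ n a₀ → a₀ < n → blueTest w j α x a₀ ≡ true → blueCand w (downFrom n) ≢ nothing
  blueCand-≢nothing (suc n) a₀ a₀<1+n test₀ e with blueTest w j α x n in test
  ... | true with () ← trans (sym e) (step-true n test)
  ... | false with a₀ ≟ n
  ...   | yes refl = true≢false (trans (sym test₀) test)
  ...   | no a₀≢n =
    blueCand-≢nothing n a₀ (≤∧≢⇒< (≤-pred a₀<1+n) a₀≢n) test₀ (trans (sym (step-false n test)) e)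

◁B-unfold : ∀ u v i α v′ → unpsi v ≡ (i , α , v′) → u ◁B v ≡ psi (i + maxW u) α (v′ ⊙ u)
◁B-unfold u v i α v′ e with unpsi v | e
... | _ | refl = refl

ValidPsi-⊙ : ∀ i α V U → ValidPsi i α V → ValidPsi (i + maxW U) α (V ⊙ U)
ValidPsi-⊙ i circ V U (1≤i , i≤) =
  ≤-trans 1≤i (m≤m+n i _) , subst (i + maxW U ≤_) (cong suc (sym (maxW-⊙ V U))) (+-monoˡ-≤ (maxW U) i≤)
ValidPsi-⊙ i bullet V U (1≤i , i≤) =
  ≤-trans 1≤i (m≤m+n i _) , subst (i + maxW U ≤_) (sym (maxW-⊙ V U)) (+-monoˡ-≤ (maxW U) i≤)

◁B-psi : ∀ U V i α → Packed V → ValidPsi i α V → U ◁B psi i α V ≡ psi (i + maxW U) α (V ⊙ U)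
◁B-psi U V i α pv valid = ◁B-unfold U (psi i α V) i α V (unpsi-psi i α V pv valid)

unpsi-◁B-psi : ∀ U V i α → Packed U → Packed V → ValidPsi i α V →
  unpsi (U ◁B psi i α V) ≡ (i + maxW U , α , V ⊙ U)
unpsi-◁B-psi U V i α pu pv valid = trans (cong unpsi (◁B-psi U V i α pv valid))
  (unpsi-psi (i + maxW U) α (V ⊙ U) (Packed-⊙ V U pv pu) (ValidPsi-⊙ i α V U valid))

-- A candidate (u, ψ_{i^α}(v)) for the blue factorization of ψ_{j^α}(x) is a cut x = v ⊙ u of this kind at c = |v|.
BlueCut : Word → ℕ → ℕ → Set
BlueCut x j c = Separated c x × (∀ b → b ∈ drop c x → b < j)

BlueCut-⊙ : ∀ V U i → Packed V → 1 ≤ i → BlueCut (V ⊙ U) (i + maxW U) (length V)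
BlueCut-⊙ V U i pv 1≤i = Separated-⊙ V U pv ,
  λ b b∈ → ≤-<-trans (∈⇒≤maxW U (subst (b ∈_) (drop-⊙ V U) b∈))
                     (subst (maxW U <_) (+-comm (maxW U) i) (m<m+n (maxW U) 1≤i))

record BlueSplit (w u : Word) (i : ℕ) (α : Color) (v : Word) : Set where
  field
    u-packed : Packed u
    v-packed : Packed v
    valid : ValidPsi i α v
    w≡ : w ≡ u ◁B psi i α v

blueTest-true⁻ : ∀ w j α x a → blueTest w j α x a ≡ true →
  BlueSplit w (blueSuffix x a) (j ∸ maxW (blueSuffix x a)) α (bluePrefix x a)
blueTest-true⁻ w j α x a e
  with e₁ , e′ ← ∧-true {isPackedᵇ (blueSuffix x a)} e
  with e₂ , e″ ← ∧-true {isPackedᵇ (bluePrefix x a)} e′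
  with e₃ , e₄ ← ∧-true {validPsiᵇ (j ∸ maxW (blueSuffix x a)) α (bluePrefix x a)} e″ = record
  { u-packed = isPackedᵇ-true⁻ _ e₁
  ; v-packed = isPackedᵇ-true⁻ _ e₂
  ; valid = validPsiᵇ-true⁻ _ _ _ e₃
  ; w≡ = ==w-true⁻ e₄
  }

blueTest-true : ∀ w j α x a → BlueSplit w (blueSuffix x a) (j ∸ maxW (blueSuffix x a)) α (bluePrefix x a) →
  blueTest w j α x a ≡ true
blueTest-true w j α x a s = true-∧ (isPackedᵇ-true _ (BlueSplit.u-packed s)) (true-∧ (isPackedᵇ-true _ (BlueSplit.v-packed s))
  (true-∧ (validPsiᵇ-true _ _ _ (BlueSplit.valid s)) (==w-true (BlueSplit.w≡ s))))

blueTest⇒BlueCut : ∀ w j α x a → unpsi w ≡ (j , α , x) → blueTest w j α x a ≡ true → BlueCut x j (length x ∸ a)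
blueTest⇒BlueCut w j α x a unpsi≡ test =
  subst₂ (λ y c → BlueCut y j c) (sym x≡) |v|≡
    (subst (λ k → BlueCut (v ⊙ u) k (length v)) (sym j≡) (BlueCut-⊙ v u i pv 1≤i))
  where
  s = blueTest-true⁻ w j α x a test
  u = blueSuffix x a
  v = bluePrefix x a
  i = j ∸ maxW u
  pv = BlueSplit.v-packed s
  1≤i = ValidPsi⇒1≤ i α v (BlueSplit.valid s)
  components : (j , α , x) ≡ (i + maxW u , α , v ⊙ u)
  components = trans (sym unpsi≡) (trans (cong unpsi (BlueSplit.w≡ s))
                 (unpsi-◁B-psi u v i α (BlueSplit.u-packed s) pv (BlueSplit.valid s)))
  j≡ : j ≡ i + maxW u
  j≡ = cong proj₁ components
  x≡ : x ≡ v ⊙ u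
  x≡ = cong (proj₂ ∘ proj₂) components
  |v|≡ : length v ≡ length x ∸ a
  |v|≡ = trans (length-map _ (take (length x ∸ a) x)) (length-take≤ (length x ∸ a) x (m∸n≤m (length x) a))

BlueCut⇒blueTest : ∀ w j α x c → unpsi w ≡ (j , α , x) → Packed x → ValidPsi j α x → psi j α x ≡ w →
  BlueCut x j c → c ≤ length x →
  blueTest w j α x (length x ∸ c) ≡ true
    × blueResult j α x (length x ∸ c) ≡ (drop c x , j ∸ maxW (drop c x) , α , unshift (maxW (drop c x)) (take c x))
BlueCut⇒blueTest w j α x c unpsi≡ px valid psi≡ (sep , below-j) c≤ =
  blueTest-true w j α x (length x ∸ c) split′ ,
  cong (λ c′ → drop c′ x , j ∸ maxW (drop c′ x) , α , unshift (maxW (drop c′ x)) (take c′ x)) |x|-a≡c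
  where
  |x|-a≡c : length x ∸ (length x ∸ c) ≡ c
  |x|-a≡c = m∸[m∸n]≡n c≤
  M = maxW (drop c x)
  u = drop c x
  v = unshift M (take c x)
  split = separated-split c x px sep
  x≡ : x ≡ v ⊙ u
  x≡ = proj₂ (proj₂ split)
  M<j : M < j
  M<j = maxW< u (ValidPsi⇒1≤ j α x valid) below-j
  i = j ∸ M
  1≤i : 1 ≤ i
  1≤i = m<n⇒0<n∸m M<j
  maxW-x : maxW x ≡ maxW v + M
  maxW-x = trans (cong maxW x≡) (maxW-⊙ v u)
  valid-v : ∀ β → ValidPsi j β x → ValidPsi i β v
  valid-v circ (_ , j≤) =
    1≤i , ≤-trans (∸-monoˡ-≤ M (subst (j ≤_) (cong suc maxW-x) j≤)) (≤-reflexive (m+n∸n≡m (suc (maxW v)) M))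
  valid-v bullet (_ , j≤) =
    1≤i , ≤-trans (∸-monoˡ-≤ M (subst (j ≤_) maxW-x j≤)) (≤-reflexive (m+n∸n≡m (maxW v) M))
  w≡ : w ≡ u ◁B psi i α v
  w≡ = sym (trans (◁B-psi u v i α (proj₁ split) (valid-v α valid))
             (trans (cong₂ (λ k y → psi k α y) (m∸n+n≡m (<⇒≤ M<j)) (sym x≡)) psi≡))
  split′ : BlueSplit w (blueSuffix x (length x ∸ c)) (j ∸ maxW (blueSuffix x (length x ∸ c))) α (bluePrefix x (length x ∸ c))
  split′ = subst (λ c′ → BlueSplit w (drop c′ x) (j ∸ maxW (drop c′ x)) α (unshift (maxW (drop c′ x)) (take c′ x)))
             (sym |x|-a≡c)
    (record { u-packed = proj₁ (proj₂ split) ; v-packed = proj₁ split ; valid = valid-v α valid ; w≡ = w≡ })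

∸-<-swap : ∀ {X V a} → X ∸ V < a → a ≤ X → X ∸ a < V
∸-<-swap {X} {V} lt a≤X = ∸-cancelʳ-< (subst (X ∸ V <_) (sym (m∸[m∸n]≡n a≤X)) lt)

<-∸-swap : ∀ {X a c} → c < X ∸ a → a < X ∸ c
<-∸-swap {X} {a} lt = ∸-cancelʳ-< (subst (_< X ∸ a) (sym (m∸[m∸n]≡n (≤-trans (<⇒≤ lt) (m∸n≤m X a)))) lt)

-- The right-child condition of a blue-packed node Node(i^α, fl, fr), stated on V = F_B^*(fr), whose maximum is ω(fr).
BlueCondition : Word → ℕ → Color → Set
BlueCondition V i α = (V ≡ [] × i ≡ 1 × α ≡ circ) ⊎ (Irreducible V × ¬ (i ≡ 1 × α ≡ circ) × 1 ≤ i × i ≤ maxW V)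

BlueCondition⇒ValidPsi : ∀ V i α → BlueCondition V i α → ValidPsi i α V
BlueCondition⇒ValidPsi .[] .1 .circ (inj₁ (refl , refl , refl)) = s≤s z≤n , s≤s z≤n
BlueCondition⇒ValidPsi V i circ (inj₂ (_ , _ , 1≤i , i≤)) = 1≤i , m≤n⇒m≤1+n i≤
BlueCondition⇒ValidPsi V i bullet (inj₂ (_ , _ , 1≤i , i≤)) = 1≤i , i≤

ValidPsi-[] : ∀ i α → ValidPsi i α [] → i ≡ 1 × α ≡ circ
ValidPsi-[] i circ (1≤i , i≤1) = ≤-antisym i≤1 1≤i , refl
ValidPsi-[] i bullet (1≤i , i≤0) = ⊥-elim (<⇒≱ 1≤i i≤0)

module BlueProduct (U V : Word) (i : ℕ) (α : Color) (pu : Packed U) (pv : Packed V) (valid : ValidPsi i α V) where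

  M = maxW U
  j = i + M
  x = V ⊙ U
  w = U ◁B psi i α V

  w≡ : w ≡ psi j α x
  w≡ = ◁B-psi U V i α pv valid

  unpsi-w : unpsi w ≡ (j , α , x)
  unpsi-w = unpsi-◁B-psi U V i α pu pv valid

  x-packed : Packed x
  x-packed = Packed-⊙ V U pv pu

  x-valid : ValidPsi j α x
  x-valid = ValidPsi-⊙ i α V U valid

  1≤i : 1 ≤ i
  1≤i = ValidPsi⇒1≤ i α V valid

  M<j : M < j
  M<j = subst (M <_) (+-comm M i) (m<m+n M 1≤i)

  length-x : length x ≡ length V + length U
  length-x = length-⊙ V U

  length-w : length w ≡ suc (length x)
  length-w = trans (cong length w≡) (length-psi j α x)

  w-packed : Packed w
  w-packed = subst Packed (sym w≡) (Packed-psi j α x x-packed x-valid)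

  maxW-w : maxW w ≡ circCount α + M + maxW V
  maxW-w = trans (cong maxW w≡) (maxW-psi α valid)
    where
    maxW-psi : ∀ β → ValidPsi i β V → maxW (psi j β x) ≡ circCount β + M + maxW V
    maxW-psi circ v = trans (maxW-psi-circ j x (ValidPsi-⊙ i circ V U v)) (cong suc (trans (maxW-⊙ V U) (+-comm (maxW V) M)))
    maxW-psi bullet v = trans (maxW-psi-bullet j x (ValidPsi-⊙ i bullet V U v)) (trans (maxW-⊙ V U) (+-comm (maxW V) M))

  |V|≤|x| : length V ≤ length x
  |V|≤|x| = subst (length V ≤_) (sym length-x) (m≤m+n _ _)

  take-x : ∀ d → d ≤ length V → take d x ≡ shift M (take d V)
  take-x d d≤ = trans (take-++ˡ d (shift M V) U (subst (d ≤_) (sym (length-shift M V)) d≤)) (take-map d V)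

  drop-x : ∀ d → d ≤ length V → drop d x ≡ shift M (drop d V) ++ U
  drop-x d d≤ = trans (drop-++ˡ d (shift M V) U (subst (d ≤_) (sym (length-shift M V)) d≤)) (cong (_++ U) (drop-map d V))

  GlobalDescent-V⇒BlueCut : ∀ d → GlobalDescent V d → (∀ b → b ∈ drop d V → b < i) → BlueCut x j d
  GlobalDescent-V⇒BlueCut d (_ , d≤ , desc) below-i = sep , below-j
    where
    d≤|V| : d ≤ length V
    d≤|V| = ≤-trans d≤ (m∸n≤m (length V) 1)
    sep : Separated d x
    sep a b a∈ b∈ with a′ , a′∈ , refl ← ∈-map⁻ (M +_) (subst (a ∈_) (take-x d d≤|V|) a∈)
      with ∈-++⁻ (shift M (drop d V)) (subst (b ∈_) (drop-x d d≤|V|) b∈)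
    ... | inj₁ b∈′ with b′ , b′∈ , refl ← ∈-map⁻ (M +_) b∈′ = +-monoʳ-< M (desc a′ b′ a′∈ b′∈)
    ... | inj₂ b∈U = ≤-<-trans (∈⇒≤maxW U b∈U) (m<m+n M (proj₁ pv a′ (∈-take⁻ d V a′∈)))
    below-j : ∀ b → b ∈ drop d x → b < j
    below-j b b∈ with ∈-++⁻ (shift M (drop d V)) (subst (b ∈_) (drop-x d d≤|V|) b∈)
    ... | inj₁ b∈′ with b′ , b′∈ , refl ← ∈-map⁻ (M +_) b∈′ =
      subst (M + b′ <_) (+-comm M i) (+-monoʳ-< M (below-i b′ b′∈))
    ... | inj₂ b∈U = ≤-<-trans (∈⇒≤maxW U b∈U) M<j

  Separated⇒GlobalDescent-V : ∀ d → 1 ≤ d → d < length V → Separated d x → GlobalDescent V d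
  Separated⇒GlobalDescent-V d 1≤d d<|V| sep =
    1≤d , ≤-pred (subst (suc d ≤_) (sym (m+[n∸m]≡n (≤-trans 1≤d (<⇒≤ d<|V|)))) d<|V|) ,
    λ a b a∈ b∈ → +-cancelˡ-< M b a (sep (M + a) (M + b)
      (subst (M + a ∈_) (sym (take-x d (<⇒≤ d<|V|))) (∈-map⁺ (M +_) a∈))
      (subst (M + b ∈_) (sym (drop-x d (<⇒≤ d<|V|))) (∈-++⁺ˡ (∈-map⁺ (M +_) b∈))))

  -- A global descent of w = ψ_{j^α}(x) at d ≤ |x|, read on the letters of x.
  Descends : ℕ → Set
  Descends d = ∀ a → a ∈ take d x → ∀ y → y ∈ map (psiLetter j α) (drop d x) ∷ʳ j → y < psiLetter j α a

  take-w : ∀ d → d ≤ length x → take d w ≡ map (psiLetter j α) (take d x)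
  take-w d d≤ = trans (cong (take d) w≡) (take-psi j α x d d≤)

  drop-w : ∀ d → d ≤ length x → drop d w ≡ map (psiLetter j α) (drop d x) ∷ʳ j
  drop-w d d≤ = trans (cong (drop d) w≡) (drop-psi j α x d d≤)

  GlobalDescent-w⇒Descends : ∀ d → GlobalDescent w d → (1 ≤ d × d ≤ length x) × Descends d
  GlobalDescent-w⇒Descends d (1≤d , d≤ , desc) = (1≤d , d≤|x|) , λ a a∈ y y∈ → desc (psiLetter j α a) y
    (subst (psiLetter j α a ∈_) (sym (take-w d d≤|x|)) (∈-map⁺ (psiLetter j α) a∈))
    (subst (y ∈_) (sym (drop-w d d≤|x|)) y∈)
    where
    d≤|x| : d ≤ length x
    d≤|x| = subst (d ≤_) (cong (_∸ 1) length-w) d≤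

  Descends⇒GlobalDescent-w : ∀ d → 1 ≤ d → d ≤ length x → Descends d → GlobalDescent w d
  Descends⇒GlobalDescent-w d 1≤d d≤|x| desc = 1≤d , subst (d ≤_) (sym (cong (_∸ 1) length-w)) d≤|x| , desc′
    where
    desc′ : ∀ a y → a ∈ take d w → y ∈ drop d w → y < a
    desc′ a y a∈ y∈ with a′ , a′∈ , refl ← ∈-map⁻ (psiLetter j α) (subst (a ∈_) (take-w d d≤|x|) a∈) =
      desc a′ a′∈ y (subst (y ∈_) (drop-w d d≤|x|) y∈)

  -- The last letter j of w lies after every descent, so the letters before it are at least j.
  GlobalDescent-w⇒j≤ : ∀ d → GlobalDescent w d → ∀ a → a ∈ take d x → j ≤ a
  GlobalDescent-w⇒j≤ d gd a a∈ with a <? j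
  ... | no a≮j = ≮⇒≥ a≮j
  ... | yes a<j = ⊥-elim (<-asym a<j (subst (j <_) (psiLetter-< j α a<j)
                    (proj₂ (GlobalDescent-w⇒Descends d gd) a a∈ j (∈-++⁺ʳ (map (psiLetter j α) (drop d x)) (here refl)))))

  private
    w≢[] : w ≢ []
    w≢[] w≡[] = psi≢[] j α x (trans (sym w≡) w≡[])

    no-descent-inside-V : BlueCondition V i α → ∀ d → GlobalDescent w d → d < length V → ⊥
    no-descent-inside-V (inj₁ (V≡[] , _)) d _ d<|V| = <⇒≱ (≤-<-trans z≤n d<|V|) (≤-reflexive (cong length V≡[]))
    no-descent-inside-V (inj₂ (V-irr , _)) d gd d<|V| with (1≤d , _) , desc ← GlobalDescent-w⇒Descends d gd =
      proj₂ V-irr d (Separated⇒GlobalDescent-V d 1≤d d<|V|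
        (λ a b a∈ b∈ → psiLetter-cancel-< j α (desc a a∈ (psiLetter j α b) (∈-++⁺ˡ (∈-map⁺ (psiLetter j α) b∈)))))

    -- At d = |V| the prefix of x is V shifted by M; this is where i^α ≠ 1° and i ≤ max V are needed.
    no-descent-at-V : BlueCondition V i α → ∀ d → GlobalDescent w d → d ≡ length V → ∀ β → α ≡ β → ⊥
    no-descent-at-V (inj₁ (V≡[] , _)) d gd d≡ _ _ =
      <⇒≱ (proj₁ (proj₁ (GlobalDescent-w⇒Descends d gd))) (≤-reflexive (trans d≡ (cong length V≡[])))
    no-descent-at-V (inj₂ (_ , not-1° , 1≤i , i≤)) d gd d≡ circ α≡ = not-1° (≤-antisym i≤1 1≤i , α≡)
      where
      M+1∈ : M + 1 ∈ take d x
      M+1∈ = subst (M + 1 ∈_) (sym (trans (take-x d (≤-reflexive d≡)) (cong (shift M) (take-all d V (≤-reflexive (sym d≡))))))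
               (∈-map⁺ (M +_) (proj₂ pv 1 ≤-refl (≤-trans 1≤i i≤)))
      i≤1 : i ≤ 1
      i≤1 = +-cancelʳ-≤ M i 1 (subst (i + M ≤_) (+-comm M 1) (GlobalDescent-w⇒j≤ d gd (M + 1) M+1∈))
    no-descent-at-V (inj₂ (_ , _ , 1≤i , i≤)) d gd d≡ bullet refl = <-irrefl (+-comm i M) j<M+i
      where
      M+i∈ : M + i ∈ take d x
      M+i∈ = subst (M + i ∈_) (sym (trans (take-x d (≤-reflexive d≡)) (cong (shift M) (take-all d V (≤-reflexive (sym d≡))))))
               (∈-map⁺ (M +_) (proj₂ pv i 1≤i i≤))
      j<M+i : j < M + i
      j<M+i = proj₂ (GlobalDescent-w⇒Descends d gd) (M + i) M+i∈ j (∈-++⁺ʳ (map (psiLetter j bullet) (drop d x)) (here refl))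

    -- Past |V| the prefix contains the first letter of U, which is at most M < j.
    no-descent-inside-U : ∀ d → GlobalDescent w d → length V < d → ∀ U′ → U′ ≡ U → ⊥
    no-descent-inside-U d gd |V|<d [] U≡ =
      <⇒≱ |V|<d (subst (d ≤_) (trans length-x (trans (cong (length V +_) (cong length (sym U≡))) (+-identityʳ _))) d≤|x|)
      where
      d≤|x| = proj₂ (proj₁ (GlobalDescent-w⇒Descends d gd))
    no-descent-inside-U d gd |V|<d (u₀ ∷ U′) U≡ =
      <⇒≱ (≤-<-trans (∈⇒≤maxW U u₀∈U) M<j) (GlobalDescent-w⇒j≤ d gd u₀ u₀∈)
      where
      u₀∈U : u₀ ∈ U
      u₀∈U = subst (u₀ ∈_) U≡ (here refl)
      n = d ∸ length V
      take-d : take d x ≡ shift M V ++ take n U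
      take-d = subst (λ d′ → take d′ x ≡ shift M V ++ take n U)
                 (trans (cong (_+ n) (length-shift M V)) (m+[n∸m]≡n (<⇒≤ |V|<d))) (take-++ʳ n (shift M V) U)
      u₀∈ : u₀ ∈ take d x
      u₀∈ = subst (u₀ ∈_) (sym take-d)
              (∈-++⁺ʳ (shift M V) (subst (λ l → u₀ ∈ take n l) U≡ (∈-take-head n (m<n⇒0<n∸m |V|<d))))

  irreducible : BlueCondition V i α → Irreducible w
  irreducible bc = w≢[] , no-descent
    where
    no-descent : ∀ d → ¬ GlobalDescent w d
    no-descent d gd with <-cmp d (length V)
    ... | tri< d<|V| _ _ = no-descent-inside-V bc d gd d<|V|
    ... | tri≈ _ d≡|V| _ = no-descent-at-V bc d gd d≡|V| α refl
    ... | tri> _ _ |V|<d = no-descent-inside-U d gd |V|<d U refl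

  NoCutInsideV : Set
  NoCutInsideV = ∀ c → c < length V → BlueCut x j c → ⊥

  no-cut-inside-V : BlueCondition V i α → NoCutInsideV
  no-cut-inside-V (inj₁ (V≡[] , _)) c c<|V| _ = <⇒≱ (≤-<-trans z≤n c<|V|) (≤-reflexive (cong length V≡[]))
  no-cut-inside-V (inj₂ (V-irr , _ , _ , i≤)) zero _ (_ , below-j) =
    <⇒≱ (+-cancelʳ-< M (maxW V) i (subst (_< i + M) (+-comm M (maxW V)) (below-j (M + maxW V) M+max∈))) i≤
    where
    M+max∈ : M + maxW V ∈ x
    M+max∈ = ∈-++⁺ˡ (∈-map⁺ (M +_) (maxW∈ V (proj₁ V-irr)))
  no-cut-inside-V (inj₂ (V-irr , _)) (suc c) c<|V| (sep , _) =
    proj₂ V-irr (suc c) (Separated⇒GlobalDescent-V (suc c) (s≤s z≤n) c<|V| sep)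

  blueFact-w : BlueCondition V i α → blueFact w ≡ just (U , i , α , V)
  blueFact-w bc = begin
    blueFact w                                         ≡⟨ blueFact-downFrom w ⟩
    blueCand w (downFrom (length w))                   ≡⟨ cong (λ n → blueCand w (downFrom n)) length-w ⟩
    blueCand w (downFrom (suc (length x)))             ≡⟨ BlueSearch.blueCand-largest w j α x unpsi-w (suc (length x)) a₀
                                                            (s≤s (m∸n≤m (length x) (length V))) (proj₁ found) later ⟩
    just (blueResult j α x a₀)                         ≡⟨ cong just (trans (proj₂ found) result≡) ⟩
    just (U , i , α , V)                               ∎
    where
    open ≡-Reasoning
    a₀ = length x ∸ length V
    found = BlueCut⇒blueTest w j α x (length V) unpsi-w x-packed x-valid (sym w≡) (BlueCut-⊙ V U i pv 1≤i) |V|≤|x|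
    result≡ : (drop (length V) x , j ∸ maxW (drop (length V) x) , α , unshift (maxW (drop (length V) x)) (take (length V) x))
            ≡ (U , i , α , V)
    result≡ rewrite drop-⊙ V U | take-⊙ V U | unshift-shift M V | m+n∸n≡m i M = refl
    later : ∀ a → a₀ < a → a < suc (length x) → blueTest w j α x a ≡ false
    later a a₀<a a≤|x| with blueTest w j α x a in test
    ... | false = refl
    ... | true = ⊥-elim (no-cut-inside-V bc (length x ∸ a) (∸-<-swap a₀<a (≤-pred a≤|x|))
                   (blueTest⇒BlueCut w j α x a unpsi-w test))

  private
    i≤maxW-V : NoCutInsideV → V ≢ [] → i ≤ maxW V
    i≤maxW-V no-cut V≢[] with i ≤? maxW V
    ... | yes i≤ = i≤
    ... | no i≰ = ⊥-elim (no-cut 0 (≢[]⇒0<length V V≢[]) ((λ _ _ ()) , below-j))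
      where
      below-j : ∀ b → b ∈ x → b < j
      below-j b b∈ = ≤-<-trans (∈⇒≤maxW x b∈) (subst (_< i + M) (sym (maxW-⊙ V U)) (+-monoˡ-< M (≰⇒> i≰)))

    -- For i^α = 1° every letter of ψ_{j°}(x) coming from V is raised above j, a descent at |V|.
    not-1° : Irreducible w → V ≢ [] → ¬ (i ≡ 1 × α ≡ circ)
    not-1° w-irr V≢[] (i≡1 , α≡circ) = proj₂ w-irr (length V)
      (Descends⇒GlobalDescent-w (length V) (≢[]⇒0<length V V≢[]) |V|≤|x| desc)
      where
      desc : Descends (length V)
      desc a a∈ y y∈ with a′ , a′∈ , refl ← ∈-map⁻ (M +_) (subst (a ∈_) (take-⊙ V U) a∈) =
        subst (y <_) (sym (raised α≡circ)) (s≤s y≤)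
        where
        j≤ : j ≤ M + a′
        j≤ = subst (_≤ M + a′) (trans (+-comm M 1) (cong (_+ M) (sym i≡1))) (+-monoʳ-≤ M (proj₁ pv a′ a′∈))
        raised : ∀ {β} → β ≡ circ → psiLetter j β (M + a′) ≡ suc (M + a′)
        raised refl = raise-≥ j≤
        y≤ : y ≤ M + a′
        y≤ with ∈-++⁻ (map (psiLetter j α) (drop (length V) x)) y∈
        ... | inj₂ (here refl) = j≤
        ... | inj₁ y∈′ with b , b∈ , refl ← ∈-map⁻ (psiLetter j α) y∈′ =
          subst (_≤ M + a′) (sym (psiLetter-< j α b<j)) (≤-trans (<⇒≤ b<j) j≤)
          where
          b<j : b < j
          b<j = ≤-<-trans (∈⇒≤maxW U (subst (b ∈_) (drop-⊙ V U) b∈)) M<j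

    -- A descent of V at d either leaves letters ≥ i behind it, which makes a descent of w at d,
    -- or leaves only letters < i, which makes a blue cut at d.
    V-irreducible : Irreducible w → NoCutInsideV → V ≢ [] → Irreducible V
    V-irreducible w-irr no-cut V≢[] = V≢[] , no-descent
      where
      no-descent : ∀ d → ¬ GlobalDescent V d
      no-descent d gd@(1≤d , d≤ , desc-V) with maxW (drop d V) <? i
      ... | yes max<i = no-cut d d<|V| (GlobalDescent-V⇒BlueCut d gd (λ b b∈ → ≤-<-trans (∈⇒≤maxW (drop d V) b∈) max<i))
        where
        d<|V| : d < length V
        d<|V| = ≤length∸1⇒< d V 1≤d d≤
      ... | no max≮i = proj₂ w-irr d (Descends⇒GlobalDescent-w d 1≤d (≤-trans (<⇒≤ d<|V|) |V|≤|x|) desc)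
        where
        d<|V| : d < length V
        d<|V| = ≤length∸1⇒< d V 1≤d d≤
        b₀ = maxW (drop d V)
        b₀∈ : b₀ ∈ drop d V
        b₀∈ = maxW∈ (drop d V) (drop≢[] d V d<|V|)
        desc : Descends d
        desc a a∈ y y∈ with a′ , a′∈ , refl ← ∈-map⁻ (M +_) (subst (a ∈_) (take-x d (<⇒≤ d<|V|)) a∈)
          with ∈-++⁻ (map (psiLetter j α) (drop d x)) y∈
        ... | inj₂ (here refl) =
          <-≤-trans (subst (_< M + a′) (+-comm M i) (+-monoʳ-< M (≤-<-trans (≮⇒≥ max≮i) (desc-V a′ b₀ a′∈ b₀∈))))
                    (≤-psiLetter j α (M + a′))
        ... | inj₁ y∈′ with z , z∈ , refl ← ∈-map⁻ (psiLetter j α) y∈′ = psiLetter-mono-< j α z<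
          where
          z< : z < M + a′
          z< with ∈-++⁻ (shift M (drop d V)) (subst (z ∈_) (drop-x d (<⇒≤ d<|V|)) z∈)
          ... | inj₁ z∈′ with b′ , b′∈ , refl ← ∈-map⁻ (M +_) z∈′ = +-monoʳ-< M (desc-V a′ b′ a′∈ b′∈)
          ... | inj₂ z∈U = ≤-<-trans (∈⇒≤maxW U z∈U) (m<m+n M (proj₁ pv a′ (∈-take⁻ d V a′∈)))

  blueCondition : Irreducible w → NoCutInsideV → BlueCondition V i α
  blueCondition w-irr no-cut with ≡[]⊎≢[] V
  ... | inj₁ V≡[] = inj₁ (V≡[] , ValidPsi-[] i α (subst (ValidPsi i α) V≡[] valid))
  ... | inj₂ V≢[] = inj₂ (V-irreducible w-irr no-cut V≢[] , not-1° w-irr V≢[] , 1≤i , i≤maxW-V no-cut V≢[])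

  blueFact-w⇒no-cut : blueFact w ≡ just (U , i , α , V) → NoCutInsideV
  blueFact-w⇒no-cut bf c c<|V| cut =
    true≢false (trans (sym (proj₁ found)) (later (length x ∸ c) a₁< (s≤s (m∸n≤m (length x) c))))
    where
    search = BlueSearch.blueCand-just⁻ w j α x unpsi-w (suc (length x)) (U , i , α , V)
               (trans (sym (cong (λ n → blueCand w (downFrom n)) length-w)) (trans (sym (blueFact-downFrom w)) bf))
    a₁ = proj₁ search
    result = proj₁ (proj₂ (proj₂ (proj₂ search)))
    later = proj₂ (proj₂ (proj₂ (proj₂ search)))
    |V|≡ : length V ≡ length x ∸ a₁
    |V|≡ = trans (cong (length ∘ proj₂ ∘ proj₂ ∘ proj₂) (sym result))
             (trans (length-map _ (take (length x ∸ a₁) x)) (length-take≤ (length x ∸ a₁) x (m∸n≤m (length x) a₁)))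
    found = BlueCut⇒blueTest w j α x c unpsi-w x-packed x-valid (sym w≡) cut (≤-trans (<⇒≤ c<|V|) |V|≤|x|)
    a₁< : a₁ < length x ∸ c
    a₁< = <-∸-swap (subst (c <_) |V|≡ c<|V|)

blueFact-just⁻ : ∀ w → Packed w → w ≢ [] → ∀ u i α v → blueFact w ≡ just (u , i , α , v) → BlueSplit w u i α v
blueFact-just⁻ w pw w≢[] u i α v bf = split {j} {β} {x} {a₀} result (blueTest-true⁻ w j β x a₀ test)
  where
  open PsiView (psiView w pw w≢[]) renaming (letter to j; color to β; rest to x)
  search = BlueSearch.blueCand-just⁻ w j β x unpsi≡ (length w) (u , i , α , v) (trans (sym (blueFact-downFrom w)) bf)
  a₀ = proj₁ search
  test = proj₁ (proj₂ (proj₂ search))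
  result = proj₁ (proj₂ (proj₂ (proj₂ search)))
  split : ∀ {j β x a} → blueResult j β x a ≡ (u , i , α , v) →
    BlueSplit w (blueSuffix x a) (j ∸ maxW (blueSuffix x a)) β (bluePrefix x a) → BlueSplit w u i α v
  split refl s = s

blueFact-sound : ∀ w → Packed w → Irreducible w → ∀ u i α v → blueFact w ≡ just (u , i , α , v) →
  Packed u × Packed v × BlueCondition v i α × w ≡ u ◁B psi i α v
blueFact-sound w pw w-irr u i α v bf = pu , pv ,
  blueCondition (subst Irreducible w≡ w-irr) (blueFact-w⇒no-cut (trans (cong blueFact (sym w≡)) bf)) , w≡
  where
  s = blueFact-just⁻ w pw (proj₁ w-irr) u i α v bf
  pu = BlueSplit.u-packed s
  pv = BlueSplit.v-packed s
  w≡ = BlueSplit.w≡ s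
  open BlueProduct u v i α pu pv (BlueSplit.valid s) hiding (w≡)

-- The cut at the very end (u = ε) always passes the test.
blueFact-≢nothing : ∀ w → Packed w → w ≢ [] → blueFact w ≢ nothing
blueFact-≢nothing w pw w≢[] bf =
  BlueSearch.blueCand-≢nothing w j α x unpsi≡ (length w) (length x ∸ length x) 0<|w| (proj₁ found)
    (trans (sym (blueFact-downFrom w)) bf)
  where
  open PsiView (psiView w pw w≢[]) renaming (letter to j; color to α; rest to x)
  empty-cut : BlueCut x j (length x)
  empty-cut rewrite drop-all (length x) x ≤-refl = (λ _ _ _ ()) , (λ _ ())
  found = BlueCut⇒blueTest w j α x (length x) unpsi≡ rest-packed valid psi≡ empty-cut ≤-refl
  0<|w| : length x ∸ length x < length w
  0<|w| rewrite n∸n≡0 (length x) | sym psi≡ | length-psi j α x = s≤s z≤n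

-- The inverse maps

sizeF-++ : ∀ xs ys → sizeF (xs ++ ys) ≡ sizeF xs + sizeF ys
sizeF-++ [] ys = refl
sizeF-++ (t ∷ xs) ys rewrite sizeF-++ xs ys = sym (+-assoc (sizeT t) (sizeF xs) (sizeF ys))

sizeF-reverse : ∀ ts → sizeF (reverse ts) ≡ sizeF ts
sizeF-reverse [] = refl
sizeF-reverse (t ∷ ts) rewrite unfold-reverse t ts | sizeF-++ (reverse ts) [ t ] | sizeF-reverse ts =
  trans (cong (sizeF ts +_) (+-identityʳ (sizeT t))) (+-comm (sizeF ts) (sizeT t))

BlueForest-++ : ∀ {xs ys} → BlueForest xs → BlueForest ys → BlueForest (xs ++ ys)
BlueForest-++ [] bys = bys
BlueForest-++ (bx ∷ bxs) bys = bx ∷ BlueForest-++ bxs bys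

BlueForest-reverse : ∀ {ts} → BlueForest ts → BlueForest (reverse ts)
BlueForest-reverse [] = []
BlueForest-reverse {t ∷ ts} (bt ∷ bts) rewrite unfold-reverse t ts = BlueForest-++ (BlueForest-reverse bts) (bt ∷ [])

All-reverse : ∀ {P : A → Set} {xs} → All P xs → All P (reverse xs)
All-reverse [] = []
All-reverse {xs = x ∷ xs} (px ∷ pxs) rewrite unfold-reverse x xs = AllP.++⁺ (All-reverse pxs) (px ∷ [])

F-B*-⊙-concat : ∀ f → F-B* f ≡ ⊙-concat (reverse (map T-B* f))
F-B*-⊙-concat [] = refl
F-B*-⊙-concat (t ∷ ts) rewrite unfold-reverse (T-B* t) (map T-B* ts) | ⊙-concat-++ (reverse (map T-B* ts)) [ T-B* t ]
  | ⊙-identityʳ (T-B* t) | F-B*-⊙-concat ts = refl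

TBf-just : ∀ k w u i α v → blueFact w ≡ just (u , i , α , v) → TBf (suc k) w ≡ node i α (FBf k u) (FBf k v)
TBf-just k w u i α v e rewrite e = refl

-- One unit of fuel per call of TBf and of FBf: a tree of size n is rebuilt with 2n units, a forest with 2n + 1.
fuel-node : ∀ a b k → 2 * suc (a + b) ≤ suc k → 2 * a + 1 ≤ k × 2 * b + 1 ≤ k
fuel-node a b k fuel = ≤-trans (+-monoˡ-≤ 1 (*-monoʳ-≤ 2 (m≤m+n a b))) 2[a+b]+1≤k ,
                       ≤-trans (+-monoˡ-≤ 1 (*-monoʳ-≤ 2 (m≤n+m b a))) 2[a+b]+1≤k
  where
  2[a+b]+1≤k : 2 * (a + b) + 1 ≤ k
  2[a+b]+1≤k = ≤-pred (subst (_≤ suc k) (trans (*-suc 2 (a + b)) (cong suc (+-comm 1 (2 * (a + b))))) fuel)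

fuel-forest : ∀ n k → 2 * n + 1 ≤ suc k → 2 * n ≤ k
fuel-forest n k fuel = ≤-pred (subst (_≤ suc k) (+-comm (2 * n) 1) fuel)

record TreeInverse (t : Tree) : Set where
  field
    packed : Packed (T-B* t)
    irreducible : Irreducible (T-B* t)
    length≡ : length (T-B* t) ≡ sizeT t
    maxW≡ : maxW (T-B* t) ≡ omegaT t
    inverse : ∀ k → 2 * sizeT t ≤ k → TBf k (T-B* t) ≡ t

record ForestInverse (f : List Tree) : Set where
  field
    packed : Packed (F-B* f)
    length≡ : length (F-B* f) ≡ sizeF f
    maxW≡ : maxW (F-B* f) ≡ omegaF f
    trees : All TreeInverse f

ForestInverse-[] : ForestInverse []
ForestInverse-[] = record { packed = Packed-[] ; length≡ = refl ; maxW≡ = refl ; trees = [] }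

ForestInverse-∷ : ∀ {t ts} → TreeInverse t → ForestInverse ts → ForestInverse (t ∷ ts)
ForestInverse-∷ {t} {ts} it ifs = record
  { packed = Packed-⊙ (F-B* ts) (T-B* t) (ForestInverse.packed ifs) (TreeInverse.packed it)
  ; length≡ = trans (length-⊙ (F-B* ts) (T-B* t))
      (trans (cong₂ _+_ (ForestInverse.length≡ ifs) (TreeInverse.length≡ it)) (+-comm (sizeF ts) (sizeT t)))
  ; maxW≡ = trans (maxW-⊙ (F-B* ts) (T-B* t))
      (trans (cong₂ _+_ (ForestInverse.maxW≡ ifs) (TreeInverse.maxW≡ it)) (+-comm (omegaF ts) (omegaT t)))
  ; trees = it ∷ ForestInverse.trees ifs
  }

map-TBf-T-B* : ∀ f → All TreeInverse f → ∀ k → 2 * sizeF f ≤ k → map (TBf k) (map T-B* f) ≡ f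
map-TBf-T-B* [] _ _ _ = refl
map-TBf-T-B* (t ∷ ts) (it ∷ its) k fuel = cong₂ _∷_
  (TreeInverse.inverse it k (≤-trans (*-monoʳ-≤ 2 (m≤m+n (sizeT t) (sizeF ts))) fuel))
  (map-TBf-T-B* ts its k (≤-trans (*-monoʳ-≤ 2 (m≤n+m (sizeF ts) (sizeT t))) fuel))

All-IrreduciblePacked-T-B* : ∀ f → All TreeInverse f → All IrreduciblePacked (map T-B* f)
All-IrreduciblePacked-T-B* [] [] = []
All-IrreduciblePacked-T-B* (t ∷ ts) (it ∷ its) =
  (TreeInverse.packed it , TreeInverse.irreducible it) ∷ All-IrreduciblePacked-T-B* ts its

FBf-F-B* : ∀ f → ForestInverse f → ∀ k → 2 * sizeF f + 1 ≤ k → FBf k (F-B* f) ≡ f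
FBf-F-B* f _ zero fuel = ⊥-elim (<⇒≱ (subst (0 <_) (+-comm 1 (2 * sizeF f)) (s≤s z≤n)) fuel)
FBf-F-B* f if (suc k) fuel = begin
  reverse (map (TBf k) (decompF (length (F-B* f)) (F-B* f)))  ≡⟨ cong (reverse ∘ map (TBf k)) decomposition ⟩
  reverse (map (TBf k) (reverse (map T-B* f)))                 ≡⟨ cong reverse (reverse-map (TBf k) (map T-B* f)) ⟩
  reverse (reverse (map (TBf k) (map T-B* f)))                 ≡⟨ reverse-involutive _ ⟩
  map (TBf k) (map T-B* f)
    ≡⟨ map-TBf-T-B* f (ForestInverse.trees if) k (fuel-forest (sizeF f) k fuel) ⟩
  f                                                            ∎
  where
  open ≡-Reasoning
  decomposition : decompF (length (F-B* f)) (F-B* f) ≡ reverse (map T-B* f)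
  decomposition = trans (cong (λ z → decompF (length z) z) (F-B*-⊙-concat f))
    (decompF-⊙-concat _ (reverse (map T-B* f)) (All-reverse (All-IrreduciblePacked-T-B* f (ForestInverse.trees if))) ≤-refl)

node-TreeInverse : ∀ i α fl fr → ForestInverse fl → ForestInverse fr → BlueCondition (F-B* fr) i α →
  TreeInverse (node i α fl fr)
node-TreeInverse i α fl fr ifl ifr bc = record
  { packed = w-packed
  ; irreducible = irreducible bc
  ; length≡ = trans length-w (cong suc (trans length-x
      (trans (cong₂ _+_ (ForestInverse.length≡ ifr) (ForestInverse.length≡ ifl)) (+-comm (sizeF fr) (sizeF fl)))))
  ; maxW≡ = trans maxW-w (cong₂ (λ a b → circCount α + a + b) (ForestInverse.maxW≡ ifl) (ForestInverse.maxW≡ ifr))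
  ; inverse = inverse
  }
  where
  open BlueProduct (F-B* fl) (F-B* fr) i α (ForestInverse.packed ifl) (ForestInverse.packed ifr)
                   (BlueCondition⇒ValidPsi (F-B* fr) i α bc)
  inverse : ∀ k → 2 * suc (sizeF fl + sizeF fr) ≤ k → TBf k w ≡ node i α fl fr
  inverse (suc k) fuel = trans (TBf-just k w (F-B* fl) i α (F-B* fr) (blueFact-w bc))
    (cong₂ (node i α) (FBf-F-B* fl ifl k (proj₁ (fuel-node (sizeF fl) (sizeF fr) k fuel)))
                      (FBf-F-B* fr ifr k (proj₂ (fuel-node (sizeF fl) (sizeF fr) k fuel))))

mutual
  BlueTree⇒TreeInverse : ∀ {t} → BlueTree t → TreeInverse t
  BlueTree⇒TreeInverse (bt0 {fl} bfl) =
    node-TreeInverse 1 circ fl [] (BlueForest⇒ForestInverse bfl) ForestInverse-[] (inj₁ (refl , refl , refl))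
  BlueTree⇒TreeInverse (bt1 {fl} {i} {α} {r} bfl br not-1° 1≤i i≤ω) =
    node-TreeInverse i α fl [ r ] (BlueForest⇒ForestInverse bfl) ifr
      (inj₂ (TreeInverse.irreducible ir , not-1° , 1≤i , subst (i ≤_) (sym (TreeInverse.maxW≡ ir)) i≤ω))
    where
    ir = BlueTree⇒TreeInverse br
    ifr = ForestInverse-∷ ir ForestInverse-[]

  BlueForest⇒ForestInverse : ∀ {f} → BlueForest f → ForestInverse f
  BlueForest⇒ForestInverse [] = ForestInverse-[]
  BlueForest⇒ForestInverse (bt ∷ bts) = ForestInverse-∷ (BlueTree⇒TreeInverse bt) (BlueForest⇒ForestInverse bts)

-- The maps F_B and T_B

IsBlueForestOf : Word → List Tree → Set
IsBlueForestOf w f = BlueForest f × sizeF f ≡ length w × F-B* f ≡ w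

IsBlueTreeOf : Word → Tree → Set
IsBlueTreeOf w t = BlueTree t × sizeT t ≡ length w × T-B* t ≡ w

ForwardF : ℕ → Set
ForwardF k = ∀ w → Packed w → 2 * length w + 1 ≤ k → IsBlueForestOf w (FBf k w)

ForwardT : ℕ → Set
ForwardT k = ∀ w → IrreduciblePacked w → 2 * length w ≤ k → IsBlueTreeOf w (TBf k w)

map-TBf : ∀ k → ForwardT k → ∀ ws → All IrreduciblePacked ws → 2 * length (⊙-concat ws) ≤ k →
  BlueForest (map (TBf k) ws) × sizeF (map (TBf k) ws) ≡ length (⊙-concat ws) × map T-B* (map (TBf k) ws) ≡ ws
map-TBf k forwardT [] [] _ = [] , refl , refl
map-TBf k forwardT (w ∷ ws) (iw ∷ iws) fuel =
  bt ∷ bts , trans (cong₂ _+_ st sts) (sym (length-⊙ w (⊙-concat ws))) , cong₂ _∷_ et ets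
  where
  fuel′ : 2 * (length w + length (⊙-concat ws)) ≤ k
  fuel′ = subst (λ n → 2 * n ≤ k) (length-⊙ w (⊙-concat ws)) fuel
  tree = forwardT w iw (≤-trans (*-monoʳ-≤ 2 (m≤m+n (length w) _)) fuel′)
  bt = proj₁ tree
  st = proj₁ (proj₂ tree)
  et = proj₂ (proj₂ tree)
  rest = map-TBf k forwardT ws iws (≤-trans (*-monoʳ-≤ 2 (m≤n+m _ (length w))) fuel′)
  bts = proj₁ rest
  sts = proj₁ (proj₂ rest)
  ets = proj₂ (proj₂ rest)

forwardF-step : ∀ k → ForwardT k → ForwardF (suc k)
forwardF-step k forwardT w pw fuel =
  BlueForest-reverse (proj₁ trees) , trans (sizeF-reverse ts) (trans (proj₁ (proj₂ trees)) length≡) , inverse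
  where
  sound = decompF-sound (length w) w pw ≤-refl
  ws = decompF (length w) w
  length≡ : length (⊙-concat ws) ≡ length w
  length≡ = cong length (proj₂ sound)
  ts = map (TBf k) ws
  trees = map-TBf k forwardT ws (proj₁ sound) (subst (λ n → 2 * n ≤ k) (sym length≡) (fuel-forest (length w) k fuel))
  inverse : F-B* (reverse ts) ≡ w
  inverse = begin
    F-B* (reverse ts)                                 ≡⟨ F-B*-⊙-concat (reverse ts) ⟩
    ⊙-concat (reverse (map T-B* (reverse ts)))        ≡⟨ cong (⊙-concat ∘ reverse) (reverse-map T-B* ts) ⟩
    ⊙-concat (reverse (reverse (map T-B* ts)))        ≡⟨ cong ⊙-concat (reverse-involutive (map T-B* ts)) ⟩
    ⊙-concat (map T-B* ts)                            ≡⟨ cong ⊙-concat (proj₂ (proj₂ trees)) ⟩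
    ⊙-concat ws                                       ≡⟨ proj₂ sound ⟩
    w                                                 ∎
    where open ≡-Reasoning

FBf-irreducible : ∀ k v → IrreduciblePacked v → FBf (suc k) v ≡ [ TBf k v ]
FBf-irreducible k v iv = cong (reverse ∘ map (TBf k)) (subst (λ z → decompF (length v) z ≡ [ v ]) (⊙-identityʳ v)
  (decompF-⊙-concat (length v) [ v ] (iv ∷ []) (≤-reflexive (cong length (⊙-identityʳ v)))))

forwardT-step : ∀ k → ForwardF (suc k) → ForwardT (suc (suc k))
forwardT-step k forwardF w (pw , w-irr) fuel with blueFact w in bf
... | nothing = ⊥-elim (blueFact-≢nothing w pw (proj₁ w-irr) bf)
... | just (u , i , α , v) = blue (proj₁ (proj₂ (proj₂ sound))) , size , inverse
  where
  sound = blueFact-sound w pw w-irr u i α v bf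
  pu = proj₁ sound
  pv = proj₁ (proj₂ sound)
  w≡ = proj₂ (proj₂ (proj₂ sound))
  open BlueProduct u v i α pu pv (BlueCondition⇒ValidPsi v i α (proj₁ (proj₂ (proj₂ sound)))) using (length-w; length-x)
  length≡ : length w ≡ suc (length u + length v)
  length≡ = trans (cong length w≡) (trans length-w (cong suc (trans length-x (+-comm (length v) (length u)))))
  fuels = fuel-node (length u) (length v) (suc k) (subst (λ n → 2 * n ≤ suc (suc k)) length≡ fuel)
  left = forwardF u pu (proj₁ fuels)
  right = forwardF v pv (proj₂ fuels)
  size : suc (sizeF (FBf (suc k) u) + sizeF (FBf (suc k) v)) ≡ length w
  size = trans (cong suc (cong₂ _+_ (proj₁ (proj₂ left)) (proj₁ (proj₂ right)))) (sym length≡)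
  inverse : F-B* (FBf (suc k) u) ◁B psi i α (F-B* (FBf (suc k) v)) ≡ w
  inverse = trans (cong₂ (λ a b → a ◁B psi i α b) (proj₂ (proj₂ left)) (proj₂ (proj₂ right))) (sym w≡)
  blue : BlueCondition v i α → BlueTree (node i α (FBf (suc k) u) (FBf (suc k) v))
  blue (inj₁ (refl , refl , refl)) = bt0 (proj₁ left)
  blue (inj₂ (v-irr , not-1° , 1≤i , i≤)) = subst (λ f → BlueTree (node i α (FBf (suc k) u) f)) (sym single)
    (bt1 (proj₁ left) bt not-1° 1≤i
      (subst (i ≤_) (trans (cong maxW (sym et)) (TreeInverse.maxW≡ (BlueTree⇒TreeInverse bt))) i≤))
    where
    single : FBf (suc k) v ≡ [ TBf k v ]
    single = FBf-irreducible k v (pv , v-irr)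
    only : ∀ {t} → BlueForest [ t ] → BlueTree t
    only (bt ∷ []) = bt
    bt : BlueTree (TBf k v)
    bt = only (subst BlueForest single (proj₁ right))
    et : T-B* (TBf k v) ≡ v
    et = subst (λ f → F-B* f ≡ v) single (proj₂ (proj₂ right))

mutual
  forwardF : ∀ k → ForwardF k
  forwardF zero w _ fuel = ⊥-elim (<⇒≱ (subst (0 <_) (+-comm 1 (2 * length w)) (s≤s z≤n)) fuel)
  forwardF (suc k) = forwardF-step k (forwardT k)

  forwardT : ∀ k → ForwardT k
  forwardT zero w (_ , w-irr) fuel = ⊥-elim (<⇒≱ (≤-trans (Irreducible⇒1≤length w-irr) (m≤m+n (length w) _)) fuel)
  forwardT (suc zero) w (_ , w-irr) fuel = ⊥-elim (<⇒≱ ≤-refl (≤-trans (*-monoʳ-≤ 2 (Irreducible⇒1≤length w-irr)) fuel))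
  forwardT (suc (suc k)) = forwardT-step k (forwardF (suc k))

mainTheorem6 : (n : ℕ) →
      ((w : Word) → Packed w → length w ≡ n →
         BlueForest (F-B w) × sizeF (F-B w) ≡ n × F-B* (F-B w) ≡ w)
    × ((f : List Tree) → BlueForest f → sizeF f ≡ n →
         Packed (F-B* f) × length (F-B* f) ≡ n × F-B (F-B* f) ≡ f)
    × ((w : Word) → Packed w → Irreducible w → length w ≡ n →
         BlueTree (T-B w) × sizeT (T-B w) ≡ n × T-B* (T-B w) ≡ w)
    × ((t : Tree) → BlueTree t → sizeT t ≡ n →
         Packed (T-B* t) × Irreducible (T-B* t) × length (T-B* t) ≡ n × T-B (T-B* t) ≡ t)
mainTheorem6 n = F-B-forward , F-B-inverse , T-B-forward , T-B-inverse
  where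
  F-B-forward : ∀ w → Packed w → length w ≡ n → BlueForest (F-B w) × sizeF (F-B w) ≡ n × F-B* (F-B w) ≡ w
  F-B-forward w pw refl = forwardF (2 * length w + 2) w pw (+-monoʳ-≤ (2 * length w) (n≤1+n 1))
  F-B-inverse : ∀ f → BlueForest f → sizeF f ≡ n → Packed (F-B* f) × length (F-B* f) ≡ n × F-B (F-B* f) ≡ f
  F-B-inverse f bf refl = ForestInverse.packed if , ForestInverse.length≡ if ,
    FBf-F-B* f if _ (subst (λ s → 2 * s + 1 ≤ 2 * length (F-B* f) + 2) (ForestInverse.length≡ if) (+-monoʳ-≤ _ (n≤1+n 1)))
    where if = BlueForest⇒ForestInverse bf
  T-B-forward : ∀ w → Packed w → Irreducible w → length w ≡ n → BlueTree (T-B w) × sizeT (T-B w) ≡ n × T-B* (T-B w) ≡ w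
  T-B-forward w pw w-irr refl = forwardT (2 * length w + 2) w (pw , w-irr) (m≤m+n (2 * length w) 2)
  T-B-inverse : ∀ t → BlueTree t → sizeT t ≡ n →
    Packed (T-B* t) × Irreducible (T-B* t) × length (T-B* t) ≡ n × T-B (T-B* t) ≡ t
  T-B-inverse t bt refl = TreeInverse.packed it , TreeInverse.irreducible it , TreeInverse.length≡ it ,
    TreeInverse.inverse it _ (subst (λ s → 2 * s ≤ 2 * length (T-B* t) + 2) (TreeInverse.length≡ it) (m≤m+n _ 2))
    where it = BlueTree⇒TreeInverse bt
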